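{- Let $k$ be a positive integer. The number of nice order ideals of $M_{2k+1,2k+3}$ that contain neither the element $1$ nor the element $2k$ is $\binom{2k-1}{k}$.
   Context: For coprime positive integers $s,t$, let $P_{s,t}=\mathbb{N}^+\setminus\{k_1s+k_2t\mid k_1,k_2\in\mathbb{N}\}$ (with $\mathbb N=\{0,1,2,\dots\}$), partially ordered by the reflexive-transitive closure of the cover relation: $x$ covers $y$ iff $x,y\in P_{s,t}$ and $x-y\in\{s,t\}$. $M_{2k+1,2k+3}$ is the subposet of $P_{2k+1,2k+3}$ obtained by removing all $y$ with $y\succeq 2k+2$. An order ideal is a down-closed subset; it is nice if it contains no two elements $x,y$ with $x-y=1$. -}

module Defs where

open import Data.Nat using (ℕ; zero; suc; _+_; _*_; _∸_; _≤_)
open import Data.Fin using (Fin; toℕ)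
open import Data.Fin.Subset using (Subset; _∈_)
open import Data.Product using (_×_; ∃₂)
open import Data.Sum using (_⊎_)
open import Relation.Nullary using (¬_)
open import Relation.Binary.PropositionalEquality using (_≡_; _≢_)
open import Relation.Binary.Construct.Closure.ReflexiveTransitive using (Star)

InSemigroup : ℕ → ℕ → ℕ → Set
InSemigroup s t n = ∃₂ λ k₁ k₂ → n ≡ k₁ * s + k₂ * t

InP : ℕ → ℕ → ℕ → Set
InP s t n = (1 ≤ n) × ¬ InSemigroup s t n

Covers : ℕ → ℕ → ℕ → ℕ → Set
Covers s t x y = InP s t x × InP s t y × ((x ≡ y + s) ⊎ (x ≡ y + t))

-- y ⪯ x : reflexive-transitive closure of the cover relation (steps go upward)
CoveredBy : ℕ → ℕ → ℕ → ℕ → Set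
CoveredBy s t y x = Covers s t x y

_⟨_,_⟩⪯_ : ℕ → ℕ → ℕ → ℕ → Set
y ⟨ s , t ⟩⪯ x = Star (CoveredBy s t) y x

sₖ tₖ : ℕ → ℕ
sₖ k = 2 * k + 1
tₖ k = 2 * k + 3

InM : ℕ → ℕ → Set
InM k y = InP (sₖ k) (tₖ k) y × ¬ ((2 * k + 2) ⟨ sₖ k , tₖ k ⟩⪯ y)

-- All elements of P_{s,t} are < s*t (Frobenius number st-s-t), so subsets of
-- M_{2k+1,2k+3} are encoded as subsets of Fin ((2k+1)(2k+3)), index i ↦ toℕ i.
Bound : ℕ → ℕ
Bound k = sₖ k * tₖ k

IsOrderIdealM : (k : ℕ) → Subset (Bound k) → Set
IsOrderIdealM k I =
  (∀ i → i ∈ I → InM k (toℕ i)) ×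
  (∀ i j → i ∈ I → InM k (toℕ j) → toℕ j ⟨ sₖ k , tₖ k ⟩⪯ toℕ i → j ∈ I)

IsNice : (k : ℕ) → Subset (Bound k) → Set
IsNice k I = ∀ i j → i ∈ I → j ∈ I → toℕ i ≢ toℕ j + 1

Avoids1and2k : (k : ℕ) → Subset (Bound k) → Set
Avoids1and2k k I = ∀ i → i ∈ I → (toℕ i ≢ 1) × (toℕ i ≢ 2 * k)

Counted : (k : ℕ) → Subset (Bound k) → Set
Counted k I = IsOrderIdealM k I × IsNice k I × Avoids1and2k k I

module Submission where

-- Write s = 2k + 1 and t = 2k + 3. Every gap n of ⟨s , t⟩ can be written n = st − I s − J t with
-- "coordinates" 1 ≤ I < t and 1 ≤ J < s, uniquely, and y ⪯ x forces the coordinates of y to dominate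
-- those of x (conversely, z ⪯ x when every intermediate point has positive coordinates). With this,
-- M consists of the cells of two triangles: for a + b < k the B-cell (a , b) is 2a + 1 + (k − 1 − a − b) t
-- and the A-cell (a , b) is one more. Inside a triangle the order is the reversed componentwise order,
-- the two triangles are incomparable, and the only consecutive cells are B(a , b), A(a , b) and
-- A(a , b + 1), B(a + 1 , b). A nice ideal is therefore described column by column by a profile: each
-- column a < k has a side and a height (an A-column of height h holds the top h cells of that column of
-- triangle A, a B-column of height h the top h + 1 cells of triangle B); along a side the height drops by
-- at most one, the side may change only after a column of height 0, column 0 is an A-column (this excludes
-- 1 = B(0 , k − 1)) and the last column has height 0 (this excludes 2k = A(k − 1 , 0)). The profiles are
-- enumerated explicitly and counted by Pascal's rule, and profiles and ideals are mutually inverse.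

open import Defs
open import Data.Nat
open import Data.Nat.Properties
open import Data.Nat.Divisibility using (_∣_; ∣⇒≤; ∣m+n∣m⇒∣n; n∣m*n; m∣m*n; 0∣⇒≡0; ∣1⇒≡1)
open import Data.Nat.Coprimality using (Coprime; coprime-divisor)
open import Data.Nat.DivMod using (_/_; _%_; m≡m%n+[m/n]*n; m%n<n; [m+kn]%n≡m%n; m<n⇒m%n≡m)
open import Data.Nat.Tactic.RingSolver using (solve-∀)
open import Data.Nat.Combinatorics using (_C_; nCk≡nC[n∸k]; nCk+nC[k+1]≡[n+1]C[k+1])
open import Data.Bool using (Bool; true; false; T; if_then_else_)
open import Data.Bool.Properties using (T-≡; ⇔→≡)
open import Data.Fin using (Fin; toℕ; fromℕ<)
open import Data.Fin.Properties using (toℕ-fromℕ<)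
open import Data.Fin.Subset using (Subset) renaming (_∈_ to _∈ₛ_)
open import Data.Fin.Subset.Properties using (⊆-antisym)
open import Data.Vec using ([]; _∷_; lookup; tabulate; there)
open import Data.Vec.Properties using (lookup∘tabulate; []=⇒lookup; lookup⇒[]=)
open import Data.List using (List; []; _∷_; map; _++_; length; applyUpTo)
open import Data.List.Properties using (length-map; length-++; ∷-injectiveʳ; ∷-injectiveˡ; length-applyUpTo)
open import Data.List.Membership.Propositional using (_∈_)
open import Data.List.Membership.Propositional.Properties using (∈-map⁺; ∈-map⁻; ∈-++⁺ˡ; ∈-++⁺ʳ; ∈-++⁻)
open import Data.List.Relation.Unary.Any using (here)
open import Data.List.Relation.Unary.All as All using (All; []; _∷_)
open import Data.List.Relation.Unary.AllPairs using (AllPairs; []; _∷_)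
import Data.List.Relation.Unary.AllPairs.Properties as AllPairs
open import Data.List.Relation.Unary.Unique.Propositional using (Unique)
import Data.List.Relation.Unary.Unique.Propositional.Properties as Unique
open import Data.Product using (Σ; ∃; ∃₂; _×_; _,_; proj₁; proj₂)
open import Data.Sum using (_⊎_; inj₁; inj₂; [_,_]′)
open import Data.Empty using (⊥)
open import Function.Bundles using (_⇔_; mk⇔; Equivalence)
open import Relation.Nullary using (¬_; Dec; yes; no; contradiction; _×-dec_; _⊎-dec_)
open import Relation.Nullary.Decidable using (⌊_⌋; map′; toWitness; fromWitness)
open import Relation.Binary.PropositionalEquality
open import Relation.Binary.Construct.Closure.ReflexiveTransitive using (ε; _◅_)

module NumericalSemigroup (s t : ℕ) .{{_ : NonZero s}} (coprime : Coprime s t) where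

  infix 4 _⪯_
  _⪯_ : ℕ → ℕ → Set
  y ⪯ x = y ⟨ s , t ⟩⪯ x

  -- n has coordinates (I , J) when n = st − Is − Jt; every gap has coordinates with I, J ≥ 1.
  record Coords (n I J : ℕ) : Set where
    constructor mkCoords
    field balance : n + I * s + J * t ≡ s * t
  open Coords public

  s∣t-coefficient : ∀ x x' e → x * s ≡ x' * s + e * t → s ∣ e
  s∣t-coefficient x x' e eq =
    coprime-divisor coprime (subst (s ∣_) (*-comm e t) (∣m+n∣m⇒∣n (subst (s ∣_) eq (n∣m*n x)) (n∣m*n x')))

  multiple-of-s : ∀ e → s ∣ e → e ≡ 0 ⊎ s ≤ e
  multiple-of-s zero    _     = inj₁ refl
  multiple-of-s (suc e) s∣1+e = inj₂ (∣⇒≤ s∣1+e)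

  -- st itself is not x s + y t with x, y ≥ 1: this is what makes numbers with positive coordinates gaps.
  st≢positive-combination : ∀ x y → 1 ≤ x → 1 ≤ y → x * s + y * t ≢ s * t
  st≢positive-combination (suc x) y _ 1≤y eq
    with multiple-of-s y (s∣t-coefficient t (suc x) y (trans (*-comm t s) (sym eq)))
  ... | inj₁ refl = contradiction 1≤y λ ()
  ... | inj₂ s≤y = <-irrefl (sym eq) (begin-strict
      s * t                 ≤⟨ *-monoˡ-≤ t s≤y ⟩
      y * t                 <⟨ m<n+m (y * t) (≤-trans (>-nonZero⁻¹ s) (m≤m+n s (x * s))) ⟩
      suc x * s + y * t     ∎)
    where open ≤-Reasoning

  cancel-t : ∀ a b y e → a + y * t ≡ b + (y + e) * t → a ≡ b + e * t
  cancel-t a b y e eq = +-cancelʳ-≡ (y * t) a (b + e * t) (trans eq (regroup b y e t))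
    where
    regroup : ∀ b y e t → b + (y + e) * t ≡ (b + e * t) + y * t
    regroup = solve-∀

  small-t-coefficient : ∀ x x' e → x * s ≡ x' * s + e * t → e < s → e ≡ 0
  small-t-coefficient x x' e eq e<s with multiple-of-s e (s∣t-coefficient x x' e eq)
  ... | inj₁ e≡0 = e≡0
  ... | inj₂ s≤e = contradiction e<s (≤⇒≯ s≤e)

  large-s-coefficient : ∀ x x' e → x' * s ≡ x * s + suc e * t → t ≤ x'
  large-s-coefficient x x' e eq with multiple-of-s (suc e) (s∣t-coefficient x' x (suc e) eq)
  ... | inj₁ ()
  ... | inj₂ s≤1+e = *-cancelʳ-≤ t x' s (begin
      t * s             ≡⟨ *-comm t s ⟩
      s * t             ≤⟨ *-monoˡ-≤ t s≤1+e ⟩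
      suc e * t         ≤⟨ m≤n+m (suc e * t) (x * s) ⟩
      x * s + suc e * t ≡⟨ sym eq ⟩
      x' * s            ∎)
    where open ≤-Reasoning

  combination-unique : ∀ {x y x' y'} → x * s + y * t ≡ x' * s + y' * t → y' < s → x' < t → x ≡ x' × y ≡ y'
  combination-unique {x} {y} {x'} {y'} eq y'<s x'<t with ≤-<-connex y y'
  ... | inj₁ y≤y' with m≤n⇒∃[o]m+o≡n y≤y'
  ...   | e , refl with small-t-coefficient x x' e (cancel-t (x * s) (x' * s) y e eq) (≤-<-trans (m≤n+m e y) y'<s)
  ...     | refl = *-cancelʳ-≡ x x' s (trans (cancel-t (x * s) (x' * s) y 0 eq) (+-identityʳ (x' * s)))
                 , sym (+-identityʳ y)
  combination-unique {x} {y} {x'} {y'} eq y'<s x'<t | inj₂ y'<y with m≤n⇒∃[o]m+o≡n y'<y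
  ... | e , refl = contradiction (large-s-coefficient x x' e (cancel-t (x' * s) (x * s) y' (suc e) (sym eq'))) (<⇒≱ x'<t)
    where
    eq' : x * s + (y' + suc e) * t ≡ x' * s + y' * t
    eq' = subst (λ z → x * s + z * t ≡ x' * s + y' * t) (sym (+-suc y' e)) eq

  -- A positive number with coordinates I, J ≥ 1 is a gap: n = a s + b t would give st = (a+I) s + (b+J) t.
  coords⇒gap : ∀ {n I J} → 1 ≤ n → Coords n I J → 1 ≤ I → 1 ≤ J → InP s t n
  coords⇒gap {n} {I} {J} 1≤n (mkCoords coords) 1≤I 1≤J = 1≤n , λ { (a , b , n≡) →
    st≢positive-combination (a + I) (b + J) (≤-trans 1≤I (m≤n+m I a)) (≤-trans 1≤J (m≤n+m J b))
      (begin
        (a + I) * s + (b + J) * t       ≡⟨ regroup a b I J s t ⟩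
        (a * s + b * t) + I * s + J * t ≡⟨ cong (λ m → m + I * s + J * t) (sym n≡) ⟩
        n + I * s + J * t               ≡⟨ coords ⟩
        s * t                           ∎) }
    where
    open ≡-Reasoning
    regroup : ∀ a b I J s t → (a + I) * s + (b + J) * t ≡ (a * s + b * t) + I * s + J * t
    regroup = solve-∀

  ⪯⇒offset : ∀ {y x} → y ⪯ x → ∃₂ λ α β → x ≡ y + α * s + β * t
  ⪯⇒offset {y} ε = 0 , 0 , regroup y s t
    where
    regroup : ∀ y s t → y ≡ y + 0 * s + 0 * t
    regroup = solve-∀
  ⪯⇒offset {y} ((_ , _ , inj₁ refl) ◅ rest) with ⪯⇒offset rest
  ... | α , β , eq = suc α , β , trans eq (regroup y s t α β)
    where
    regroup : ∀ y s t α β → (y + s) + α * s + β * t ≡ y + suc α * s + β * t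
    regroup = solve-∀
  ⪯⇒offset {y} ((_ , _ , inj₂ refl) ◅ rest) with ⪯⇒offset rest
  ... | α , β , eq = α , suc β , trans eq (regroup y s t α β)
    where
    regroup : ∀ y s t α β → (y + t) + α * s + β * t ≡ y + α * s + suc β * t
    regroup = solve-∀

  coords-offset : ∀ {z α β I J} → Coords (z + α * s + β * t) I J → Coords z (α + I) (β + J)
  coords-offset {z} {α} {β} {I} {J} (mkCoords coords) = mkCoords (trans (regroup z α β I J s t) coords)
    where
    regroup : ∀ z α β I J s t → z + (α + I) * s + (β + J) * t ≡ (z + α * s + β * t) + I * s + J * t
    regroup = solve-∀

  coords-offset⁻¹ : ∀ {z α β I J} → Coords z (α + I) (β + J) → Coords (z + α * s + β * t) I J
  coords-offset⁻¹ {z} {α} {β} {I} {J} (mkCoords coords) = mkCoords (trans (sym (regroup z α β I J s t)) coords)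
    where
    regroup : ∀ z α β I J s t → z + (α + I) * s + (β + J) * t ≡ (z + α * s + β * t) + I * s + J * t
    regroup = solve-∀

  coords-injective : ∀ {n m I J} → Coords n I J → Coords m I J → n ≡ m
  coords-injective {n} {m} {I} {J} (mkCoords cn) (mkCoords cm) =
    +-cancelʳ-≡ (I * s + J * t) n m (trans (sym (+-assoc n _ _)) (trans cn (trans (sym cm) (+-assoc m _ _))))

  coords-unique : ∀ {n I J I' J'} → Coords n I J → Coords n I' J' → I' < t → J' < s → I ≡ I' × J ≡ J'
  coords-unique {n} {I} {J} {I'} {J'} (mkCoords c) (mkCoords c') I'<t J'<s =
    combination-unique (+-cancelˡ-≡ n _ _ (trans (sym (+-assoc n _ _)) (trans c (trans (sym c') (+-assoc n _ _))))) J'<s I'<t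

  ⪯⇒coords-≥ : ∀ {x y I J I' J'} → Coords x I J → Coords y I' J' → I' < t → J' < s → y ⪯ x → I ≤ I' × J ≤ J'
  ⪯⇒coords-≥ {x} {y} {I} {J} cx cy I'<t J'<s y⪯x with ⪯⇒offset y⪯x
  ... | α , β , refl with coords-unique (coords-offset {y} {α} {β} cx) cy I'<t J'<s
  ...   | α+I≡I' , β+J≡J' = subst (I ≤_) α+I≡I' (m≤n+m I α) , subst (J ≤_) β+J≡J' (m≤n+m J β)

  private
    positive : ∀ m n → 1 ≤ m + suc n
    positive m n = subst (1 ≤_) (sym (+-suc m n)) (s≤s z≤n)

  -- Conversely, starting from z ≥ 1 with coordinates (α + 1 + I , β + 1 + J), the numbers visited on the way
  -- up to z + α s + β t all have positive coordinates, hence are gaps, so z ⪯ z + α s + β t.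
  climb : ∀ α β {z I J} → 1 ≤ z → Coords z (α + suc I) (β + suc J) → z ⪯ z + α * s + β * t
  climb zero zero {z} _ _ = subst (z ⪯_) (sym (trans (+-identityʳ (z + 0)) (+-identityʳ z))) ε
  climb (suc α) β {z} {I} {J} 1≤z coords =
    (coords⇒gap 1≤z+s coords' (positive α I) (positive β J) , coords⇒gap 1≤z coords (s≤s z≤n) (positive β J) , inj₁ refl)
    ◅ subst (z + s ⪯_) (regroup-top z s t α β) (climb α β 1≤z+s coords')
    where
    1≤z+s : 1 ≤ z + s
    1≤z+s = ≤-trans 1≤z (m≤m+n z s)
    coords' : Coords (z + s) (α + suc I) (β + suc J)
    coords' = mkCoords (trans (regroup z s t α β I J) (balance coords))
      where
      regroup : ∀ z s t α β I J → (z + s) + (α + suc I) * s + (β + suc J) * t ≡ z + (suc α + suc I) * s + (β + suc J) * t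
      regroup = solve-∀
    regroup-top : ∀ z s t α β → (z + s) + α * s + β * t ≡ z + suc α * s + β * t
    regroup-top = solve-∀
  climb zero (suc β) {z} {I} {J} 1≤z coords =
    (coords⇒gap 1≤z+t coords' (s≤s z≤n) (positive β J) , coords⇒gap 1≤z coords (s≤s z≤n) (s≤s z≤n) , inj₂ refl)
    ◅ subst (z + t ⪯_) (regroup-top z s t β) (climb zero β {I = I} {J = J} 1≤z+t coords')
    where
    1≤z+t : 1 ≤ z + t
    1≤z+t = ≤-trans 1≤z (m≤m+n z t)
    coords' : Coords (z + t) (zero + suc I) (β + suc J)
    coords' = mkCoords (trans (regroup z s t β I J) (balance coords))
      where
      regroup : ∀ z s t β I J → (z + t) + suc I * s + (β + suc J) * t ≡ z + suc I * s + (suc β + suc J) * t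
      regroup = solve-∀
    regroup-top : ∀ z s t β → (z + t) + 0 * s + β * t ≡ z + 0 * s + suc β * t
    regroup-top = solve-∀

  coords⇒<st : ∀ {n I J} → Coords n (suc I) J → n < s * t
  coords⇒<st {n} {I} {J} (mkCoords coords) = begin-strict
    n                         <⟨ m<m+n n (>-nonZero⁻¹ s) ⟩
    n + s                     ≤⟨ m≤m+n (n + s) (I * s + J * t) ⟩
    n + s + (I * s + J * t)   ≡⟨ regroup n s t I J ⟩
    n + suc I * s + J * t     ≡⟨ coords ⟩
    s * t                     ∎
    where
    open ≤-Reasoning
    regroup : ∀ n s t I J → n + s + (I * s + J * t) ≡ n + suc I * s + J * t
    regroup = solve-∀

  coords-suc-I : ∀ {x y I J} → Coords y (suc I) J → Coords x I J → x ≡ y + s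
  coords-suc-I {x} {y} {I} {J} cy cx = coords-injective cx (mkCoords (trans (regroup y s t I J) (balance cy)))
    where
    regroup : ∀ y s t I J → (y + s) + I * s + J * t ≡ y + suc I * s + J * t
    regroup = solve-∀

  coords-suc-J : ∀ {x y I J} → Coords y I (suc J) → Coords x I J → x ≡ y + t
  coords-suc-J {x} {y} {I} {J} cy cx = coords-injective cx (mkCoords (trans (regroup y s t I J) (balance cy)))
    where
    regroup : ∀ y s t I J → (y + t) + I * s + J * t ≡ y + I * s + suc J * t
    regroup = solve-∀

  coords⇒sum<st : ∀ {n I J} → 1 ≤ n → Coords n I J → I * s + J * t < s * t
  coords⇒sum<st {n} {I} {J} 1≤n (mkCoords coords) =
    subst (I * s + J * t <_) (trans (sym (+-assoc n (I * s) (J * t))) coords) (m<n+m (I * s + J * t) 1≤n)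

tₖ≡sₖ+2 : ∀ k → tₖ k ≡ sₖ k + 2
tₖ≡sₖ+2 k = sym (+-assoc (2 * k) 1 2)

sₖ-nonZero : ∀ k → NonZero (sₖ k)
sₖ-nonZero k = subst NonZero (+-comm 1 (2 * k)) _

tₖ-nonZero : ∀ k → NonZero (tₖ k)
tₖ-nonZero k = subst NonZero (+-comm 3 (2 * k)) _

-- A common divisor of 2k+1 and 2k+3 divides 2, and 2k+1 is odd, so it is 1.
sₖ-coprime-tₖ : ∀ k → Coprime (sₖ k) (tₖ k)
sₖ-coprime-tₖ k {d} (d∣s , d∣t) = divides-2-and-odd d (∣m+n∣m⇒∣n (subst (d ∣_) (tₖ≡sₖ+2 k) d∣t) d∣s) d∣s
  where
  divides-2-and-odd : ∀ d → d ∣ 2 → d ∣ sₖ k → d ≡ 1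
  divides-2-and-odd 0 d∣2 _ = contradiction (0∣⇒≡0 d∣2) λ ()
  divides-2-and-odd 1 _ _ = refl
  divides-2-and-odd 2 _ 2∣s = contradiction (∣1⇒≡1 (∣m+n∣m⇒∣n 2∣s (m∣m*n k))) λ ()
  divides-2-and-odd (suc (suc (suc d))) d∣2 _ with ∣⇒≤ d∣2
  ... | s≤s (s≤s ())

module Semigroupₖ (k : ℕ) = NumericalSemigroup (sₖ k) (tₖ k) {{sₖ-nonZero k}} (sₖ-coprime-tₖ k)
open Semigroupₖ

-- Write a gap n as r + q s with r < s (here s = 2k+1 and t = 2k+3 = s + 2).
-- For r = 2e: if e ≤ q then n = (q − e) s + e t; otherwise q + 1 + u = e, s = e + 1 + v and
-- (u + 1 , v + 1) are coordinates.
coords-even-remainder : ∀ s t n e q → t ≡ s + 2 → n ≡ e * 2 + q * s → e < s → ¬ InSemigroup s t n →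
                        ∃₂ λ I J → n + suc I * s + suc J * t ≡ s * t
coords-even-remainder s t n e q refl refl e<s n∉ with ≤-<-connex e q
... | inj₁ e≤q with m≤n⇒∃[o]m+o≡n e≤q
...   | u , refl = contradiction (u , e , in-semigroup e u s) n∉
  where
  in-semigroup : ∀ e u s → e * 2 + (e + u) * s ≡ u * s + e * (s + 2)
  in-semigroup = solve-∀
coords-even-remainder s t n e q refl refl e<s n∉ | inj₂ q<e with m≤n⇒∃[o]m+o≡n q<e | m≤n⇒∃[o]m+o≡n e<s
... | u , refl | v , refl = u , v , coordinates q u v
  where
  coordinates : ∀ q u v → ((suc q + u) * 2 + q * (suc (suc q + u) + v)) + suc u * (suc (suc q + u) + v)
                          + suc v * ((suc (suc q + u) + v) + 2) ≡ (suc (suc q + u) + v) * ((suc (suc q + u) + v) + 2)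
  coordinates = solve-∀

-- For r = 2e + 1 (so e < k, say k = e + 1 + v): if e + k + 2 ≤ q then n = (q − e − k − 1) s + (e + k + 1) t;
-- otherwise q + u = e + k + 1 for some u and (u + 1 , v + 1) are coordinates.
coords-odd-remainder : ∀ k n e q → n ≡ suc (e * 2) + q * sₖ k → e < k → ¬ InSemigroup (sₖ k) (tₖ k) n →
                       ∃₂ λ I J → Coords k n (suc I) (suc J)
coords-odd-remainder k n e q refl e<k n∉ with suc (e + suc k) ≤? q
... | yes e+k+2≤q with m≤n⇒∃[o]m+o≡n e+k+2≤q
...   | u , refl = contradiction (u , e + suc k , in-semigroup k e u) n∉
  where
  in-semigroup : ∀ k e u → suc (e * 2) + (suc (e + suc k) + u) * (2 * k + 1) ≡ u * (2 * k + 1) + (e + suc k) * (2 * k + 3)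
  in-semigroup = solve-∀
coords-odd-remainder k n e q refl e<k n∉ | no e+k+2≰q
  with m≤n⇒∃[o]m+o≡n (≤-pred (≰⇒> e+k+2≰q)) | m≤n⇒∃[o]m+o≡n e<k
... | u , q+u≡e+k+1 | v , refl = u , v , mkCoords (begin
    suc (e * 2) + q * s + suc u * s + suc v * t         ≡⟨ regroup e q u v s t ⟩
    suc (e * 2) + (q + u) * s + s + suc v * t           ≡⟨ cong (λ m → suc (e * 2) + m * s + s + suc v * t) q+u≡e+k+1 ⟩
    suc (e * 2) + (e + suc k) * s + s + suc v * t       ≡⟨ coordinates e v ⟩
    s * t                                               ∎)
  where
  open ≡-Reasoning
  s = sₖ k
  t = tₖ k
  regroup : ∀ e q u v s t → suc (e * 2) + q * s + suc u * s + suc v * t ≡ suc (e * 2) + (q + u) * s + s + suc v * t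
  regroup = solve-∀
  coordinates : ∀ e v → suc (e * 2) + (e + suc (suc e + v)) * (2 * (suc e + v) + 1) + (2 * (suc e + v) + 1)
                        + suc v * (2 * (suc e + v) + 3) ≡ (2 * (suc e + v) + 1) * (2 * (suc e + v) + 3)
  coordinates = solve-∀

gap⇒coords : ∀ k {n} → ¬ InSemigroup (sₖ k) (tₖ k) n → ∃₂ λ I J → Coords k n (suc I) (suc J)
gap⇒coords k {n} n∉ = by-parity (n % sₖ k) (m%n<n n (sₖ k)) (m≡m%n+[m/n]*n n (sₖ k))
  where
  instance _ = sₖ-nonZero k
  by-parity : ∀ r → r < sₖ k → n ≡ r + n / sₖ k * sₖ k → ∃₂ λ I J → Coords k n (suc I) (suc J)
  by-parity r r<s n≡ with r % 2 | m%n<n r 2 | m≡m%n+[m/n]*n r 2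
  ... | 0 | _ | r≡ = wrap (coords-even-remainder (sₖ k) (tₖ k) n (r / 2) (n / sₖ k) (tₖ≡sₖ+2 k)
                       (trans n≡ (cong (_+ n / sₖ k * sₖ k) r≡)) (≤-<-trans (m≤m*n (r / 2) 2) (subst (_< sₖ k) r≡ r<s)) n∉)
    where
    wrap : (∃₂ λ I J → n + suc I * sₖ k + suc J * tₖ k ≡ sₖ k * tₖ k) → ∃₂ λ I J → Coords k n (suc I) (suc J)
    wrap (I , J , balance) = I , J , mkCoords balance
  ... | 1 | _ | r≡ = coords-odd-remainder k n (r / 2) (n / sₖ k) (trans n≡ (cong (_+ n / sₖ k * sₖ k) r≡))
                       (*-cancelʳ-< 2 (r / 2) k (subst (r / 2 * 2 <_) (*-comm 2 k)
                         (≤-pred (subst (λ m → suc m ≤ suc (2 * k)) r≡ r<1+2k)))) n∉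
    where
    r<1+2k : r < suc (2 * k)
    r<1+2k = subst (r <_) (+-comm (2 * k) 1) r<s
  ... | suc (suc _) | s≤s (s≤s ()) | _

-- M_{2k+1,2k+3} is the disjoint union of two triangles A and B of cells (a , b) with a + b < k.
data Side : Set where
  A B : Side

A≢B : A ≢ B
A≢B ()

-- The cell (a , b) of a side is residue + slack · t, where residue is 2a + 1 on B and 2a + 2 on A
-- and the slack e = k − 1 − a − b is the distance of the cell from the hypotenuse a + b = k − 1.
residue : Side → ℕ → ℕ
residue B a = suc (2 * a)
residue A a = suc (suc (2 * a))

slack : ℕ → ℕ → ℕ → ℕ
slack k a b = k ∸ suc (a + b)

cell : ℕ → Side → ℕ → ℕ → ℕ
cell k σ a b = residue σ a + slack k a b * tₖ k

column<k : ∀ {k a b} → a + b < k → a < k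
column<k {a = a} {b} = ≤-<-trans (m≤m+n a b)

row<k : ∀ {k a b} → a + b < k → b < k
row<k {a = a} {b} = ≤-<-trans (m≤n+m b a)

I-coord : ℕ → Side → ℕ → ℕ
I-coord k A a = suc a
I-coord k B a = suc (suc (a + k))

J-coord : ℕ → Side → ℕ → ℕ
J-coord k A b = suc (b + k)
J-coord k B b = suc b

cell-coords : ∀ k σ a b → a + b < k → Coords k (cell k σ a b) (I-coord k σ a) (J-coord k σ b)
cell-coords k σ a b a+b<k with m≤n⇒∃[o]m+o≡n a+b<k
cell-coords .(suc (a + b) + e) A a b _ | e , refl rewrite m+n∸m≡n (suc (a + b)) e = mkCoords (identity a b e)
  where
  identity : ∀ a b e → suc (suc (2 * a)) + e * (2 * (suc (a + b) + e) + 3) + suc a * (2 * (suc (a + b) + e) + 1)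
    + suc (b + (suc (a + b) + e)) * (2 * (suc (a + b) + e) + 3) ≡ (2 * (suc (a + b) + e) + 1) * (2 * (suc (a + b) + e) + 3)
  identity = solve-∀
cell-coords .(suc (a + b) + e) B a b _ | e , refl rewrite m+n∸m≡n (suc (a + b)) e = mkCoords (identity a b e)
  where
  identity : ∀ a b e → suc (2 * a) + e * (2 * (suc (a + b) + e) + 3) + suc (suc (a + (suc (a + b) + e))) * (2 * (suc (a + b) + e) + 1)
    + suc b * (2 * (suc (a + b) + e) + 3) ≡ (2 * (suc (a + b) + e) + 1) * (2 * (suc (a + b) + e) + 3)
  identity = solve-∀

cell-coords-reduced : ∀ k σ a b → a + b < k → I-coord k σ a < tₖ k × J-coord k σ b < sₖ k
cell-coords-reduced k σ a b a+b<k with m≤n⇒∃[o]m+o≡n a+b<k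
cell-coords-reduced .(suc (a + b) + e) A a b _ | e , refl =
  m+n≤o⇒m≤o _ (≤-reflexive (I-identity a b e)) , m+n≤o⇒m≤o _ (≤-reflexive (J-identity a b e))
  where
  I-identity : ∀ a b e → suc (suc a) + (a + 2 * b + 2 * e + 3) ≡ 2 * (suc (a + b) + e) + 3
  I-identity = solve-∀
  J-identity : ∀ a b e → suc (suc (b + (suc (a + b) + e))) + (a + e) ≡ 2 * (suc (a + b) + e) + 1
  J-identity = solve-∀
cell-coords-reduced .(suc (a + b) + e) B a b _ | e , refl =
  m+n≤o⇒m≤o _ (≤-reflexive (I-identity a b e)) , m+n≤o⇒m≤o _ (≤-reflexive (J-identity a b e))
  where
  I-identity : ∀ a b e → suc (suc (suc (a + (suc (a + b) + e)))) + suc (b + e) ≡ 2 * (suc (a + b) + e) + 3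
  I-identity = solve-∀
  J-identity : ∀ a b e → suc (suc b) + (2 * a + b + 2 * e + 1) ≡ 2 * (suc (a + b) + e) + 1
  J-identity = solve-∀

coords-2k+2 : ∀ k → Coords k (2 * k + 2) (suc k) k
coords-2k+2 k = mkCoords (identity k)
  where
  identity : ∀ k → (2 * k + 2) + suc k * (2 * k + 1) + k * (2 * k + 3) ≡ (2 * k + 1) * (2 * k + 3)
  identity = solve-∀

coords-2k+2-reduced : ∀ k → suc k < tₖ k × k < sₖ k
coords-2k+2-reduced k = m+n≤o⇒m≤o _ (≤-reflexive (I-identity k)) , m+n≤o⇒m≤o _ (≤-reflexive (J-identity k))
  where
  I-identity : ∀ k → suc (suc k) + suc k ≡ 2 * k + 3
  I-identity = solve-∀
  J-identity : ∀ k → suc k + k ≡ 2 * k + 1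
  J-identity = solve-∀

-- Every cell lies in M: it is a gap, and it is not above 2k+2 because one of its coordinates is too large.
cell-in-M : ∀ k σ a b → a + b < k → InM k (cell k σ a b)
cell-in-M k σ a b a+b<k = coords⇒gap k (positive σ) coords (I-positive σ) (J-positive σ) , not-above σ
  where
  coords = cell-coords k σ a b a+b<k
  positive : ∀ σ → 1 ≤ cell k σ a b
  positive A = s≤s z≤n
  positive B = s≤s z≤n
  I-positive : ∀ σ → 1 ≤ I-coord k σ a
  I-positive A = s≤s z≤n
  I-positive B = s≤s z≤n
  J-positive : ∀ σ → 1 ≤ J-coord k σ b
  J-positive A = s≤s z≤n
  J-positive B = s≤s z≤n
  not-above : ∀ σ → ¬ ((2 * k + 2) ⟨ sₖ k , tₖ k ⟩⪯ cell k σ a b)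
  not-above σ above with ⪯⇒coords-≥ k (cell-coords k σ a b a+b<k) (coords-2k+2 k)
                                      (proj₁ (coords-2k+2-reduced k)) (proj₂ (coords-2k+2-reduced k)) above
  not-above A above | _ , b+k<k = contradiction b+k<k (<⇒≱ (s≤s (m≤n+m k b)))
  not-above B above | a+k+2≤k+1 , _ = contradiction (≤-pred a+k+2≤k+1) (<⇒≱ (s≤s (m≤n+m k a)))

-- Coordinates of the shape of a cell but with a + b ≥ k exceed st (so cannot belong to a positive number).
A-coords-too-large : ∀ k a b → k ≤ a + b → sₖ k * tₖ k ≤ suc a * sₖ k + suc (b + k) * tₖ k
A-coords-too-large k a b k≤a+b with m≤n⇒∃[o]m+o≡n k≤a+b
... | x , k+x≡a+b = ≤-trans (m≤m+n (sₖ k * tₖ k) _) (≤-reflexive (sym excess))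
  where
  identity : ∀ k a b x → suc a * (2 * k + 1) + suc (b + k) * (2 * k + 3) + (k + x) * (2 * k + 1)
                         ≡ ((2 * k + 1) * (2 * k + 3) + suc (2 * b + x * (2 * k + 1))) + (a + b) * (2 * k + 1)
  identity = solve-∀
  excess : suc a * sₖ k + suc (b + k) * tₖ k ≡ sₖ k * tₖ k + suc (2 * b + x * sₖ k)
  excess = +-cancelʳ-≡ ((a + b) * sₖ k) _ _
             (trans (cong (λ m → suc a * sₖ k + suc (b + k) * tₖ k + m * sₖ k) (sym k+x≡a+b)) (identity k a b x))

B-coords-too-large : ∀ k a b → k ≤ a + b → sₖ k * tₖ k ≤ suc (suc (a + k)) * sₖ k + suc b * tₖ k
B-coords-too-large k a b k≤a+b with m≤n⇒∃[o]m+o≡n k≤a+b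
... | x , k+x≡a+b = ≤-trans (m≤m+n (sₖ k * tₖ k) _) (≤-reflexive (sym excess))
  where
  identity : ∀ k a b x → suc (suc (a + k)) * (2 * k + 1) + suc b * (2 * k + 3) + (k + x) * (2 * k + 1)
                         ≡ ((2 * k + 1) * (2 * k + 3) + suc (suc (2 * b + x * (2 * k + 1)))) + (a + b) * (2 * k + 1)
  identity = solve-∀
  excess : suc (suc (a + k)) * sₖ k + suc b * tₖ k ≡ sₖ k * tₖ k + suc (suc (2 * b + x * sₖ k))
  excess = +-cancelʳ-≡ ((a + b) * sₖ k) _ _
             (trans (cong (λ m → suc (suc (a + k)) * sₖ k + suc b * tₖ k + m * sₖ k) (sym k+x≡a+b)) (identity k a b x))

IsCell : ℕ → ℕ → Set
IsCell k n = ∃ λ σ → ∃₂ λ a b → a + b < k × n ≡ cell k σ a b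

-- Every element of M is a cell: its coordinates (I , J) either have J > k (an A-cell), or J ≤ k and I > k + 1
-- (a B-cell), or else I ≤ k + 1 and J ≤ k, and then 2k + 2 ⪯ n by climbing.
M⇒cell : ∀ k {n} → InM k n → IsCell k n
M⇒cell k {n} ((1≤n , n∉) , not-above) = by-coords (gap⇒coords k n∉)
  where
  A-cell : ∀ a b → Coords k n (suc a) (suc (b + k)) → IsCell k n
  A-cell a b coords with suc (a + b) ≤? k
  ... | yes a+b<k = A , a , b , a+b<k , coords-injective k coords (cell-coords k A a b a+b<k)
  ... | no a+b≮k = contradiction (A-coords-too-large k a b (≤-pred (≰⇒> a+b≮k))) (<⇒≱ (coords⇒sum<st k 1≤n coords))

  B-cell : ∀ a b → Coords k n (suc (suc (a + k))) (suc b) → IsCell k n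
  B-cell a b coords with suc (a + b) ≤? k
  ... | yes a+b<k = B , a , b , a+b<k , coords-injective k coords (cell-coords k B a b a+b<k)
  ... | no a+b≮k = contradiction (B-coords-too-large k a b (≤-pred (≰⇒> a+b≮k))) (<⇒≱ (coords⇒sum<st k 1≤n coords))

  above-2k+2 : ∀ I J α β → I + α ≡ k → suc J + β ≡ k → Coords k n (suc I) (suc J) → (2 * k + 2) ⟨ sₖ k , tₖ k ⟩⪯ n
  above-2k+2 I J α β I+α≡k 1+J+β≡k coords =
    subst (_ ⟨ sₖ k , tₖ k ⟩⪯_) (coords-injective k (coords-offset⁻¹ k coords-2k+2') coords)
          (climb k α β (≤-trans (s≤s z≤n) (m≤n+m 2 (2 * k))) coords-2k+2')
    where
    coords-2k+2' : Coords k (2 * k + 2) (α + suc I) (β + suc J)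
    coords-2k+2' = subst₂ (Coords k (2 * k + 2))
                          (trans (cong suc (sym I+α≡k)) (+-comm (suc I) α))
                          (trans (sym 1+J+β≡k) (+-comm (suc J) β)) (coords-2k+2 k)

  by-coords : (∃₂ λ I J → Coords k n (suc I) (suc J)) → IsCell k n
  by-coords (I , J , coords) with k ≤? J | k <? I
  ... | yes k≤J | _ with m≤n⇒∃[o]m+o≡n k≤J
  ...   | b , refl = A-cell I b (subst (λ j → Coords k n (suc I) (suc j)) (+-comm k b) coords)
  by-coords (I , J , coords) | no k≰J | yes k<I with m≤n⇒∃[o]m+o≡n k<I
  ...   | a , refl = B-cell a J (subst (λ i → Coords k n (suc (suc i)) (suc J)) (+-comm k a) coords)
  by-coords (I , J , coords) | no k≰J | no k≮I =
    contradiction (above-2k+2 I J _ _ (proj₂ (m≤n⇒∃[o]m+o≡n (≮⇒≥ k≮I))) (proj₂ (m≤n⇒∃[o]m+o≡n (≰⇒> k≰J))) coords)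
                  not-above

remainder-unique : ∀ n .{{_ : NonZero n}} {r r' q q'} → r + q * n ≡ r' + q' * n → r < n → r' < n → r ≡ r' × q ≡ q'
remainder-unique n {r} {r'} {q} {q'} eq r<n r'<n =
  r≡r' , *-cancelʳ-≡ q q' n (+-cancelˡ-≡ r _ _ (trans eq (cong (_+ q' * n) (sym r≡r'))))
  where
  open ≡-Reasoning
  r≡r' : r ≡ r'
  r≡r' = begin
    r                 ≡⟨ sym (m<n⇒m%n≡m r<n) ⟩
    r % n             ≡⟨ sym ([m+kn]%n≡m%n r q n) ⟩
    (r + q * n) % n   ≡⟨ cong (_% n) eq ⟩
    (r' + q' * n) % n ≡⟨ [m+kn]%n≡m%n r' q' n ⟩
    r' % n            ≡⟨ m<n⇒m%n≡m r'<n ⟩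
    r'                ∎

suc-residue<t : ∀ k σ a → a < k → suc (residue σ a) < tₖ k
suc-residue<t k σ a a<k = ≤-trans (by-side σ) (≤-trans (≤-reflexive (identity a)) (+-monoˡ-≤ 3 (*-monoʳ-≤ 2 a<k)))
  where
  identity : ∀ a → suc (suc (suc (suc (suc (2 * a))))) ≡ 2 * suc a + 3
  identity = solve-∀
  by-side : ∀ σ → suc (suc (residue σ a)) ≤ suc (suc (suc (suc (suc (2 * a)))))
  by-side A = n≤1+n _
  by-side B = ≤-trans (n≤1+n _) (n≤1+n _)

residue<t : ∀ k σ a → a < k → residue σ a < tₖ k
residue<t k σ a a<k = <-trans (n<1+n (residue σ a)) (suc-residue<t k σ a a<k)

residue-injective : ∀ {σ σ' a a'} → residue σ a ≡ residue σ' a' → σ ≡ σ' × a ≡ a'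
residue-injective {A} {A} {a} {a'} eq = refl , *-cancelˡ-≡ a a' 2 (suc-injective (suc-injective eq))
residue-injective {B} {B} {a} {a'} eq = refl , *-cancelˡ-≡ a a' 2 (suc-injective eq)
residue-injective {A} {B} {a} {a'} eq = contradiction (suc-injective eq) (λ e → even≢odd a' a (sym e))
residue-injective {B} {A} {a} {a'} eq = contradiction (suc-injective eq) (even≢odd a a')

slack-injective : ∀ {k a b a' b'} → a + b < k → a' + b' < k → slack k a b ≡ slack k a' b' → a + b ≡ a' + b'
slack-injective {k} {a} {b} {a'} {b'} a+b<k a'+b'<k eq =
  suc-injective (∸-cancelˡ-≡ a+b<k a'+b'<k eq)

cell-injective : ∀ k σ a b σ' a' b' → a + b < k → a' + b' < k → cell k σ a b ≡ cell k σ' a' b' → σ ≡ σ' × a ≡ a' × b ≡ b'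
cell-injective k σ a b σ' a' b' a+b<k a'+b'<k eq
  with remainder-unique (tₖ k) {{tₖ-nonZero k}} {q = slack k a b} {q' = slack k a' b'} eq
         (residue<t k σ a (column<k a+b<k)) (residue<t k σ' a' (column<k a'+b'<k))
... | same-residue , same-slack with residue-injective same-residue
...   | refl , refl = refl , refl , +-cancelˡ-≡ a b b' (slack-injective {k} {a} {b} {a} {b'} a+b<k a'+b'<k same-slack)

B+1≡A : ∀ k a b → cell k B a b + 1 ≡ cell k A a b
B+1≡A k a b = +-comm (cell k B a b) 1

A+1≡B : ∀ k a b → cell k A a (suc b) + 1 ≡ cell k B (suc a) b
A+1≡B k a b rewrite +-suc a b = identity a (slack k (suc a) b * tₖ k)
  where
  identity : ∀ a x → suc (suc (2 * a)) + x + 1 ≡ suc (2 * suc a) + x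
  identity = solve-∀

suc-residue-A : ∀ a → suc (residue A a) ≡ residue B (suc a)
suc-residue-A a = cong suc (sym (*-suc 2 a))

cell-consecutive : ∀ k σ a b σ' a' b' → a + b < k → a' + b' < k → cell k σ a b ≡ cell k σ' a' b' + 1 →
                   (σ ≡ A × σ' ≡ B × a ≡ a' × b ≡ b') ⊎ (σ ≡ B × σ' ≡ A × a ≡ suc a' × b' ≡ suc b)
cell-consecutive k σ a b σ' a' b' a+b<k a'+b'<k eq
  with remainder-unique (tₖ k) {{tₖ-nonZero k}} {q = slack k a b} {q' = slack k a' b'}
         (trans eq (+-comm (cell k σ' a' b') 1)) (residue<t k σ a (column<k a+b<k)) (suc-residue<t k σ' a' (column<k a'+b'<k))
... | same-residue , same-slack with σ'
...   | B with residue-injective {σ} {A} {a} {a'} same-residue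
...     | refl , refl = inj₁ (refl , refl , refl , +-cancelˡ-≡ a b b' (slack-injective {k} {a} {b} {a} {b'} a+b<k a'+b'<k same-slack))
cell-consecutive k σ a b σ' a' b' a+b<k a'+b'<k eq | same-residue , same-slack | A
  with residue-injective {σ} {B} {a} {suc a'} (trans same-residue (suc-residue-A a'))
... | refl , refl = inj₂ (refl , refl , refl ,
        sym (+-cancelˡ-≡ a' (suc b) b' (trans (+-suc a' b) (slack-injective {k} {suc a'} {b} {a'} {b'} a+b<k a'+b'<k same-slack))))

cell-⪯ : ∀ k σ a b σ' a' b' → a + b < k → a' + b' < k → cell k σ' a' b' ⟨ sₖ k , tₖ k ⟩⪯ cell k σ a b →
         σ ≡ σ' × a ≤ a' × b ≤ b'
cell-⪯ k σ a b σ' a' b' a+b<k a'+b'<k below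
  with ⪯⇒coords-≥ k (cell-coords k σ a b a+b<k) (cell-coords k σ' a' b' a'+b'<k)
                    (proj₁ (cell-coords-reduced k σ' a' b' a'+b'<k)) (proj₂ (cell-coords-reduced k σ' a' b' a'+b'<k)) below
cell-⪯ k A a b A a' b' _ _ _ | I≤I' , J≤J' = refl , ≤-pred I≤I' , +-cancelʳ-≤ k b b' (≤-pred J≤J')
cell-⪯ k B a b B a' b' _ _ _ | I≤I' , J≤J' = refl , +-cancelʳ-≤ k a a' (≤-pred (≤-pred I≤I')) , ≤-pred J≤J'
cell-⪯ k A a b B a' b' _ a'+b'<k _ | _ , J≤J' =
  contradiction (≤-trans (m≤n+m k b) (≤-pred J≤J')) (<⇒≱ (row<k a'+b'<k))
cell-⪯ k B a b A a' b' _ a'+b'<k _ | I≤I' , _ =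
  contradiction (≤-trans (m≤n+m k a) (≤-pred (≤-trans (n≤1+n _) I≤I'))) (<⇒≱ (column<k a'+b'<k))

cover-column : ∀ k σ a b → suc a + b < k → cell k σ (suc a) b ⟨ sₖ k , tₖ k ⟩⪯ cell k σ a b
cover-column k σ a b 1+a+b<k =
  (proj₁ (cell-in-M k σ a b a+b<k) , proj₁ (cell-in-M k σ (suc a) b 1+a+b<k) ,
   inj₁ (coords-suc-I k (subst (λ i → Coords k (cell k σ (suc a) b) i (J-coord k σ b)) (I-coord-suc σ)
                                (cell-coords k σ (suc a) b 1+a+b<k))
                          (cell-coords k σ a b a+b<k))) ◅ ε
  where
  a+b<k = ≤-trans (n≤1+n _) 1+a+b<k
  I-coord-suc : ∀ σ → I-coord k σ (suc a) ≡ suc (I-coord k σ a)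
  I-coord-suc A = refl
  I-coord-suc B = refl

cover-row : ∀ k σ a b → a + suc b < k → cell k σ a (suc b) ⟨ sₖ k , tₖ k ⟩⪯ cell k σ a b
cover-row k σ a b a+1+b<k =
  (proj₁ (cell-in-M k σ a b a+b<k) , proj₁ (cell-in-M k σ a (suc b) a+1+b<k) ,
   inj₂ (coords-suc-J k (subst (Coords k (cell k σ a (suc b)) (I-coord k σ a)) (J-coord-suc σ) (cell-coords k σ a (suc b) a+1+b<k))
                          (cell-coords k σ a b a+b<k))) ◅ ε
  where
  J-coord-suc : ∀ σ → J-coord k σ (suc b) ≡ suc (J-coord k σ b)
  J-coord-suc A = refl
  J-coord-suc B = refl
  a+b<k = ≤-trans (s≤s (+-monoʳ-≤ a (n≤1+n b))) a+1+b<k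

cell<Bound : ∀ k σ a b → a + b < k → cell k σ a b < Bound k
cell<Bound k A a b a+b<k = coords⇒<st k (cell-coords k A a b a+b<k)
cell<Bound k B a b a+b<k = coords⇒<st k (cell-coords k B a b a+b<k)

cell-one : ∀ m → cell (suc m) B 0 m ≡ 1
cell-one m rewrite n∸n≡0 m = refl

cell-2k : ∀ m → cell (suc m) A m 0 ≡ 2 * suc m
cell-2k m = trans (cong (λ e → residue A m + e * tₖ (suc m)) (trans (cong (m ∸_) (+-identityʳ m)) (n∸n≡0 m))) (identity m)
  where
  identity : ∀ m → suc (suc (2 * m)) + 0 ≡ 2 * suc m
  identity = solve-∀

M<Bound : ∀ k {n} → InM k n → n < Bound k
M<Bound k n∈M with M⇒cell k n∈M
... | σ , a , b , a+b<k , refl = cell<Bound k σ a b a+b<k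

map-unique : ∀ {X Y : Set} {P : X → Set} (f : X → Y) {xs} → (∀ {x y} → P x → P y → f x ≡ f y → x ≡ y) →
             All P xs → Unique xs → Unique (map f xs)
map-unique {P = P} f injective ps u = AllPairs.map⁺ (distinct-images ps u)
  where
  distinct-images : ∀ {xs} → All P xs → Unique xs → AllPairs (λ x y → f x ≢ f y) xs
  distinct-images []         []         = []
  distinct-images (px ∷ ps') (x≢ ∷ u') =
    All.zipWith (λ (py , x≢y) fx≡fy → x≢y (injective px py fx≡fy)) (ps' , x≢) ∷ distinct-images ps' u'

-- A nice order ideal is described column by column: each column a carries a side (which triangle it
-- occupies) and a height.
record Column : Set where
  constructor column
  field
    side   : Side
    height : ℕ
open Column public

Follows : Column → Column → Set
Follows x y = height x ≡ 0 ⊎ (side x ≡ side y × height x ≤ suc (height y))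

Admissible : List Column → Set
Admissible []          = ⊥
Admissible (x ∷ [])    = height x ≡ 0
Admissible (x ∷ y ∷ r) = Follows x y × Admissible (y ∷ r)

admissible-height : ∀ x r → Admissible (x ∷ r) → height x ≤ length r
admissible-height x []      h≡0                 = ≤-reflexive h≡0
admissible-height x (y ∷ r) (inj₁ h≡0 , _)      = subst (_≤ length (y ∷ r)) (sym h≡0) z≤n
admissible-height x (y ∷ r) (inj₂ (_ , h≤) , ok) = ≤-trans h≤ (s≤s (admissible-height y r ok))

-- Explicit enumeration of admissible sequences of length n + 1:
--   startingWith n σ w       those starting with column σ w,
--   startingInRange n σ w f  those starting with column σ w' for w ≤ w' < w + f,
--   startingAtLeast n σ w    those starting with column σ w' for w ≤ w' (w' ≤ n is forced).
mutual
  startingWith : ℕ → Side → ℕ → List (List Column)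
  startingWith zero    σ zero    = (column σ 0 ∷ []) ∷ []
  startingWith zero    σ (suc w) = []
  startingWith (suc n) σ zero    = map (column σ 0 ∷_) (startingAtLeast n A 0 ++ startingAtLeast n B 0)
  startingWith (suc n) σ (suc w) = map (column σ (suc w) ∷_) (startingAtLeast n σ w)

  startingInRange : ℕ → Side → ℕ → ℕ → List (List Column)
  startingInRange n σ w zero    = []
  startingInRange n σ w (suc f) = startingWith n σ w ++ startingInRange n σ (suc w) f

  startingAtLeast : ℕ → Side → ℕ → List (List Column)
  startingAtLeast n σ w = startingInRange n σ w (suc n ∸ w)

mutual
  startingWith-sound : ∀ n σ w xs → xs ∈ startingWith n σ w →
                       ∃ λ r → xs ≡ column σ w ∷ r × length r ≡ n × Admissible xs
  startingWith-sound zero σ zero xs (here refl) = [] , refl , refl , refl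
  startingWith-sound (suc n) σ zero xs xs∈ with ∈-map⁻ (column σ 0 ∷_) xs∈
  ... | ys , ys∈ , refl with [ (A ,_) , (B ,_) ]′ (∈-++⁻ (startingAtLeast n A 0) ys∈)
  ...   | σ' , ys∈σ' with startingAtLeast-sound n σ' 0 ys ys∈σ'
  ...     | w' , _ , ys∈E with startingWith-sound n σ' w' ys ys∈E
  ...       | r , refl , len , ok = _ , refl , cong suc len , inj₁ refl , ok
  startingWith-sound (suc n) σ (suc w) xs xs∈ with ∈-map⁻ (column σ (suc w) ∷_) xs∈
  ... | ys , ys∈ , refl with startingAtLeast-sound n σ w ys ys∈
  ...   | w' , w≤w' , ys∈E with startingWith-sound n σ w' ys ys∈E
  ...     | r , refl , len , ok = _ , refl , cong suc len , inj₂ (refl , s≤s w≤w') , ok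

  startingInRange-sound : ∀ n σ w f xs → xs ∈ startingInRange n σ w f → ∃ λ w' → w ≤ w' × xs ∈ startingWith n σ w'
  startingInRange-sound n σ w (suc f) xs xs∈ with ∈-++⁻ (startingWith n σ w) xs∈
  ... | inj₁ xs∈E = w , ≤-refl , xs∈E
  ... | inj₂ xs∈R with startingInRange-sound n σ (suc w) f xs xs∈R
  ...   | w' , w<w' , xs∈E = w' , ≤-trans (n≤1+n w) w<w' , xs∈E

  startingAtLeast-sound : ∀ n σ w xs → xs ∈ startingAtLeast n σ w → ∃ λ w' → w ≤ w' × xs ∈ startingWith n σ w'
  startingAtLeast-sound n σ w = startingInRange-sound n σ w (suc n ∸ w)

mutual
  startingWith-complete : ∀ n σ w r → Admissible (column σ w ∷ r) → length r ≡ n → column σ w ∷ r ∈ startingWith n σ w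
  startingWith-complete zero σ .0 [] refl refl = here refl
  startingWith-complete (suc n) σ zero (column A w' ∷ r) (_ , ok) len =
    ∈-map⁺ _ (∈-++⁺ˡ (startingAtLeast-complete n A 0 w' r ok (suc-injective len) z≤n))
  startingWith-complete (suc n) σ zero (column B w' ∷ r) (_ , ok) len =
    ∈-map⁺ _ (∈-++⁺ʳ (startingAtLeast n A 0) (startingAtLeast-complete n B 0 w' r ok (suc-injective len) z≤n))
  startingWith-complete (suc n) σ (suc w) (column σ' w' ∷ r) (inj₂ (refl , s≤s w≤1+w') , ok) len =
    ∈-map⁺ _ (startingAtLeast-complete n σ w w' r ok (suc-injective len) w≤1+w')

  startingAtLeast-complete : ∀ n σ w w' r → Admissible (column σ w' ∷ r) → length r ≡ n → w ≤ w' →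
                             column σ w' ∷ r ∈ startingAtLeast n σ w
  startingAtLeast-complete n σ w w' r ok len w≤w' =
    startingInRange-complete n σ w (suc n ∸ w) w' _ (startingWith-complete n σ w' r ok len) w≤w' w'<w+f
    where
    w'≤n : w' ≤ n
    w'≤n = subst (w' ≤_) len (admissible-height (column σ w') r ok)
    w'<w+f : w' < w + (suc n ∸ w)
    w'<w+f = subst (w' <_) (sym (m+[n∸m]≡n (≤-trans w≤w' (≤-trans w'≤n (n≤1+n n))))) (s≤s w'≤n)

  startingInRange-complete : ∀ n σ w f w' xs → xs ∈ startingWith n σ w' → w ≤ w' → w' < w + f → xs ∈ startingInRange n σ w f
  startingInRange-complete n σ w zero w' xs xs∈ w≤w' w'<w+0 =
    contradiction (subst (_≤ w') (sym (+-identityʳ w)) w≤w') (<⇒≱ w'<w+0)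
  startingInRange-complete n σ w (suc f) w' xs xs∈ w≤w' w'<w+f with m≤n⇒m<n∨m≡n w≤w'
  ... | inj₂ refl = ∈-++⁺ˡ xs∈
  ... | inj₁ w<w' = ∈-++⁺ʳ (startingWith n σ w)
                      (startingInRange-complete n σ (suc w) f w' xs xs∈ w<w' (subst (w' <_) (+-suc w f) w'<w+f))

-- The enumeration has no repetitions: different first columns give different sequences.
first-column : ∀ n σ w xs → xs ∈ startingWith n σ w → ∃ λ r → xs ≡ column σ w ∷ r
first-column n σ w xs xs∈ with startingWith-sound n σ w xs xs∈
... | r , eq , _ = r , eq

mutual
  startingWith-unique : ∀ n σ w → Unique (startingWith n σ w)
  startingWith-unique zero σ zero = [] ∷ []
  startingWith-unique zero σ (suc w) = []
  startingWith-unique (suc n) σ zero =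
    Unique.map⁺ ∷-injectiveʳ (Unique.++⁺ (startingAtLeast-unique n A 0) (startingAtLeast-unique n B 0) disjoint)
    where
    disjoint : ∀ {v} → ¬ (v ∈ startingAtLeast n A 0 × v ∈ startingAtLeast n B 0)
    disjoint {v} (v∈A , v∈B) with startingAtLeast-sound n A 0 v v∈A | startingAtLeast-sound n B 0 v v∈B
    ... | w₁ , _ , v∈A' | w₂ , _ , v∈B' with first-column n A w₁ v v∈A' | first-column n B w₂ v v∈B'
    ...   | _ , refl | _ , ()
  startingWith-unique (suc n) σ (suc w) = Unique.map⁺ ∷-injectiveʳ (startingAtLeast-unique n σ w)

  startingInRange-unique : ∀ n σ w f → Unique (startingInRange n σ w f)
  startingInRange-unique n σ w zero = []
  startingInRange-unique n σ w (suc f) =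
    Unique.++⁺ (startingWith-unique n σ w) (startingInRange-unique n σ (suc w) f) disjoint
    where
    disjoint : ∀ {v} → ¬ (v ∈ startingWith n σ w × v ∈ startingInRange n σ (suc w) f)
    disjoint {v} (v∈E , v∈R) with startingInRange-sound n σ (suc w) f v v∈R
    ... | w' , w<w' , v∈E' with first-column n σ w v v∈E | first-column n σ w' v v∈E'
    ...   | _ , e₁ | _ , e₂ = <⇒≢ w<w' (cong height (∷-injectiveˡ (trans (sym e₁) e₂)))

  startingAtLeast-unique : ∀ n σ w → Unique (startingAtLeast n σ w)
  startingAtLeast-unique n σ w = startingInRange-unique n σ w (suc n ∸ w)

-- Counting: with w + d = n there are C(n + d, d) admissible sequences of length n + 1 starting with
-- column σ w; the recursion is Pascal's rule, and the two sides after a column of height 0 add up to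
-- C(2n + 1, n) + C(2n + 1, n) = C(2n + 2, n + 1).
doubled-central : ∀ n → (suc n + n) C n + (suc n + n) C n ≡ (suc n + suc n) C (suc n)
doubled-central n = begin
  (suc n + n) C n + (suc n + n) C n       ≡⟨ cong ((suc n + n) C n +_) symmetric ⟩
  (suc n + n) C n + (suc n + n) C suc n   ≡⟨ nCk+nC[k+1]≡[n+1]C[k+1] (suc n + n) n ⟩
  suc (suc n + n) C suc n                 ≡⟨ cong (_C suc n) (sym (+-suc (suc n) n)) ⟩
  (suc n + suc n) C suc n                 ∎
  where
  open ≡-Reasoning
  symmetric : (suc n + n) C n ≡ (suc n + n) C suc n
  symmetric = trans (nCk≡nC[n∸k] (≤-trans (n≤1+n n) (m≤m+n (suc n) n))) (cong ((suc n + n) C_) (m+n∸n≡m (suc n) n))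

mutual
  startingWith-length : ∀ n σ w d → w + d ≡ n → length (startingWith n σ w) ≡ (n + d) C d
  startingWith-length zero σ zero zero refl = refl
  startingWith-length (suc n) σ zero .(suc n) refl = begin
    length (map (column σ 0 ∷_) (startingAtLeast n A 0 ++ startingAtLeast n B 0))
      ≡⟨ length-map _ (startingAtLeast n A 0 ++ startingAtLeast n B 0) ⟩
    length (startingAtLeast n A 0 ++ startingAtLeast n B 0)
      ≡⟨ length-++ (startingAtLeast n A 0) ⟩
    length (startingAtLeast n A 0) + length (startingAtLeast n B 0)
      ≡⟨ cong₂ _+_ (startingAtLeast-length n A 0 n refl) (startingAtLeast-length n B 0 n refl) ⟩
    (suc n + n) C n + (suc n + n) C n
      ≡⟨ doubled-central n ⟩
    (suc n + suc n) C suc n ∎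
    where open ≡-Reasoning
  startingWith-length (suc n) σ (suc w) d w+d≡n =
    trans (length-map _ (startingAtLeast n σ w)) (startingAtLeast-length n σ w d (suc-injective w+d≡n))

  startingInRange-length : ∀ n σ w d → w + d ≡ n → length (startingInRange n σ w (suc d)) ≡ (suc n + d) C d
  startingInRange-length n σ w zero w+0≡n =
    trans (length-++ (startingWith n σ w)) (trans (+-identityʳ _) (startingWith-length n σ w 0 w+0≡n))
  startingInRange-length n σ w (suc d) w+d≡n = begin
    length (startingWith n σ w ++ startingInRange n σ (suc w) (suc d))
      ≡⟨ length-++ (startingWith n σ w) ⟩
    length (startingWith n σ w) + length (startingInRange n σ (suc w) (suc d))
      ≡⟨ cong₂ _+_ (startingWith-length n σ w (suc d) w+d≡n)
                   (startingInRange-length n σ (suc w) d (trans (sym (+-suc w d)) w+d≡n)) ⟩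
    (n + suc d) C suc d + (suc n + d) C d
      ≡⟨ cong ((n + suc d) C suc d +_) (cong (_C d) (sym (+-suc n d))) ⟩
    (n + suc d) C suc d + (n + suc d) C d
      ≡⟨ +-comm ((n + suc d) C suc d) _ ⟩
    (n + suc d) C d + (n + suc d) C suc d
      ≡⟨ nCk+nC[k+1]≡[n+1]C[k+1] (n + suc d) d ⟩
    suc (n + suc d) C suc d ∎
    where open ≡-Reasoning

  startingAtLeast-length : ∀ n σ w d → w + d ≡ n → length (startingAtLeast n σ w) ≡ (suc n + d) C d
  startingAtLeast-length n σ w d refl rewrite +-∸-assoc 1 (m≤m+n w d) | m+n∸m≡n w d =
    startingInRange-length (w + d) σ w d refl

-- Reading an admissible sequence column by column (out of range we return an arbitrary column).
columnAt : List Column → ℕ → Column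
columnAt []       _       = column A 0
columnAt (c ∷ cs) zero    = c
columnAt (c ∷ cs) (suc a) = columnAt cs a

admissible-follows : ∀ cs a → Admissible cs → suc a < length cs → Follows (columnAt cs a) (columnAt cs (suc a))
admissible-follows (x ∷ [])    a       ok          (s≤s ())
admissible-follows (x ∷ y ∷ r) zero    (x→y , _)   _           = x→y
admissible-follows (x ∷ y ∷ r) (suc a) (_ , ok)    (s≤s a+1<) = admissible-follows (y ∷ r) a ok a+1<

admissible-last : ∀ cs a → Admissible cs → suc a ≡ length cs → height (columnAt cs a) ≡ 0
admissible-last (x ∷ [])    zero    ok       _   = ok
admissible-last (x ∷ y ∷ r) (suc a) (_ , ok) len = admissible-last (y ∷ r) a ok (suc-injective len)

admissible-height-at : ∀ cs a → Admissible cs → a < length cs → height (columnAt cs a) + a < length cs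
admissible-height-at (x ∷ r) zero ok _ =
  s≤s (subst (_≤ length r) (sym (+-identityʳ _)) (admissible-height x r ok))
admissible-height-at (x ∷ y ∷ r) (suc a) (_ , ok) (s≤s a<) =
  s≤s (subst (_≤ length (y ∷ r)) (sym (+-suc _ a)) (admissible-height-at (y ∷ r) a ok a<))

admissible-from : ∀ cs → 1 ≤ length cs → (∀ a → suc a < length cs → Follows (columnAt cs a) (columnAt cs (suc a))) →
                  (∀ a → suc a ≡ length cs → height (columnAt cs a) ≡ 0) → Admissible cs
admissible-from (x ∷ [])    _ follows last = last 0 refl
admissible-from (x ∷ y ∷ r) _ follows last =
  follows 0 (s≤s (s≤s z≤n)) ,
  admissible-from (y ∷ r) (s≤s z≤n) (λ a a+1< → follows (suc a) (s≤s a+1<)) (λ a len → last (suc a) (cong suc len))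

columnAt-applyUpTo : ∀ (f : ℕ → Column) n a → a < n → columnAt (applyUpTo f n) a ≡ f a
columnAt-applyUpTo f (suc n) zero    _        = refl
columnAt-applyUpTo f (suc n) (suc a) (s≤s a<n) = columnAt-applyUpTo (λ x → f (suc x)) n a a<n

applyUpTo-columnAt : ∀ (f : ℕ → Column) cs n → length cs ≡ n → (∀ a → a < n → f a ≡ columnAt cs a) → applyUpTo f n ≡ cs
applyUpTo-columnAt f []       zero    _   _    = refl
applyUpTo-columnAt f (c ∷ cs) (suc n) len same =
  cong₂ _∷_ (same 0 (s≤s z≤n)) (applyUpTo-columnAt (λ a → f (suc a)) cs n (suc-injective len) (λ a a<n → same (suc a) (s≤s a<n)))

∈-tabulate⇔ : ∀ {n} {P : ℕ → Set} (P? : ∀ x → Dec (P x)) (i : Fin n) →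
              i ∈ₛ tabulate (λ j → ⌊ P? (toℕ j) ⌋) ⇔ P (toℕ i)
∈-tabulate⇔ {P = P} P? i = mk⇔
  (λ i∈ → toWitness (Equivalence.from T-≡ (trans (sym (lookup∘tabulate (λ j → ⌊ P? (toℕ j) ⌋) i)) ([]=⇒lookup i∈))))
  (λ Pi → lookup⇒[]= i _ (trans (lookup∘tabulate (λ j → ⌊ P? (toℕ j) ⌋) i) (Equivalence.to T-≡ (fromWitness Pi))))

_≟ₛ_ : (σ σ' : Side) → Dec (σ ≡ σ')
A ≟ₛ A = yes refl
B ≟ₛ B = yes refl
A ≟ₛ B = no λ ()
B ≟ₛ A = no λ ()

Profile : ℕ → List Column → Set
Profile k cs = length cs ≡ k × Admissible cs × side (columnAt cs 0) ≡ A

-- An A-column of height h holds h cells, a B-column h + 1 cells (so B-columns are never empty).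
offset : Side → ℕ
offset A = 0
offset B = 1

-- Column a occupies the cell (a , b) of side σ when it has side σ and the cell is among its top
-- offset σ + height cells (column a of a triangle has the k − a cells b < k − a).
Occupies : ℕ → List Column → Side → ℕ → ℕ → Set
Occupies k cs σ a b = side (columnAt cs a) ≡ σ × k ≤ offset σ + height (columnAt cs a) + b + a

InIdealOf : ℕ → List Column → ℕ → Set
InIdealOf k cs n = ∃ λ σ → ∃₂ λ a b → a + b < k × n ≡ cell k σ a b × Occupies k cs σ a b

inIdealOf? : ∀ k cs n → Dec (InIdealOf k cs n)
inIdealOf? k cs n = map′ from-search to-search (anyUpTo? (λ a → anyUpTo? (λ b → cell? a b A ⊎-dec cell? a b B) k) k)
  where
  Cell : ℕ → ℕ → Side → Set
  Cell a b σ = a + b < k × n ≡ cell k σ a b × Occupies k cs σ a b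
  cell? : ∀ a b σ → Dec (Cell a b σ)
  cell? a b σ = suc (a + b) ≤? k ×-dec (n ≟ cell k σ a b ×-dec
                ((side (columnAt cs a) ≟ₛ σ) ×-dec (k ≤? offset σ + height (columnAt cs a) + b + a)))
  from-search : (∃ λ a → a < k × ∃ λ b → b < k × (Cell a b A ⊎ Cell a b B)) → InIdealOf k cs n
  from-search (a , _ , b , _ , inj₁ c) = A , a , b , c
  from-search (a , _ , b , _ , inj₂ c) = B , a , b , c
  to-search : InIdealOf k cs n → ∃ λ a → a < k × ∃ λ b → b < k × (Cell a b A ⊎ Cell a b B)
  to-search (A , a , b , c) = a , column<k (proj₁ c) , b , row<k (proj₁ c) , inj₁ c
  to-search (B , a , b , c) = a , column<k (proj₁ c) , b , row<k (proj₁ c) , inj₂ c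

idealOf : (k : ℕ) → List Column → Subset (Bound k)
idealOf k cs = tabulate (λ i → ⌊ inIdealOf? k cs (toℕ i) ⌋)

∈-idealOf⇔ : ∀ k cs (i : Fin (Bound k)) → i ∈ₛ idealOf k cs ⇔ InIdealOf k cs (toℕ i)
∈-idealOf⇔ k cs = ∈-tabulate⇔ (inIdealOf? k cs)

-- Along a row, an occupied cell forces the next column to be occupied too (columns shrink by at most one).
occupies-next-column : ∀ k cs σ a b → Profile k cs → Occupies k cs σ a b → suc a + b < k → Occupies k cs σ (suc a) b
occupies-next-column k cs σ a b (len , ok , _) (σ-side , k≤) a+1+b<k
  with admissible-follows cs a ok (subst (suc (suc a) ≤_) (sym len) (≤-trans (s≤s (s≤s (m≤m+n a b))) a+1+b<k))
... | inj₁ h≡0 = contradiction (≤-trans k≤ (+-monoˡ-≤ a (+-monoˡ-≤ b (offset+0≤1 σ h≡0))))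
                             (<⇒≱ (subst (λ m → suc (suc m) ≤ k) (+-comm a b) a+1+b<k))
  where
  offset+0≤1 : ∀ σ → height (columnAt cs a) ≡ 0 → offset σ + height (columnAt cs a) ≤ 1
  offset+0≤1 A h≡0 = ≤-trans (≤-reflexive h≡0) z≤n
  offset+0≤1 B h≡0 = s≤s (≤-reflexive h≡0)
... | inj₂ (same-side , h≤h'+1) = trans (sym same-side) σ-side ,
  ≤-trans k≤ (≤-trans (+-monoˡ-≤ a (+-monoˡ-≤ b (+-monoʳ-≤ (offset σ) h≤h'+1)))
                      (≤-reflexive (shift (offset σ) _ b a)))
  where
  shift : ∀ o h b a → o + suc h + b + a ≡ o + h + b + suc a
  shift o h b a = trans (cong (λ m → m + b + a) (+-suc o h)) (sym (+-suc (o + h + b) a))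

occupies-monotone : ∀ k cs σ a b a' b' → Profile k cs → Occupies k cs σ a b → a ≤ a' → b ≤ b' → a' + b' < k →
                    Occupies k cs σ a' b'
occupies-monotone k cs σ a b a' b' profile occ a≤a' b≤b' a'+b'<k with m≤n⇒∃[o]m+o≡n a≤a'
... | δ , refl = along-row δ (proj₁ occ , ≤-trans (proj₂ occ) (+-monoˡ-≤ a (+-monoʳ-≤ _ b≤b'))) a'+b'<k
  where
  along-row : ∀ δ → Occupies k cs σ a b' → (a + δ) + b' < k → Occupies k cs σ (a + δ) b'
  along-row zero occ' _ = subst (λ x → Occupies k cs σ x b') (sym (+-identityʳ a)) occ'
  along-row (suc δ) occ' a+δ+1+b'<k = subst (λ x → Occupies k cs σ x b') (sym (+-suc a δ))
    (occupies-next-column k cs σ (a + δ) b' profile (along-row δ occ' (≤-trans (n≤1+n _) lt)) lt)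
    where
    lt : suc (a + δ) + b' < k
    lt = subst (λ x → x + b' < k) (+-suc a δ) a+δ+1+b'<k

next-column-side : ∀ k cs a b → Profile k cs → Occupies k cs A a b → a + b < k → suc a < k → side (columnAt cs (suc a)) ≡ A
next-column-side k cs a b (len , ok , _) (A-side , k≤) a+b<k a+1<k with admissible-follows cs a ok (subst (suc (suc a) ≤_) (sym len) a+1<k)
... | inj₁ h≡0 = contradiction (subst (λ h → k ≤ h + b + a) h≡0 k≤) (<⇒≱ (subst (_< k) (+-comm a b) a+b<k))
... | inj₂ (same-side , _) = trans (sym same-side) A-side

idealOf-counted : ∀ m cs → Profile (suc m) cs → Counted (suc m) (idealOf (suc m) cs)
idealOf-counted m cs profile@(_ , ok , first-side) = (in-M , down-closed) , nice , avoids
  where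
  k = suc m
  member : ∀ i → i ∈ₛ idealOf k cs → InIdealOf k cs (toℕ i)
  member i = Equivalence.to (∈-idealOf⇔ k cs i)

  in-M : ∀ i → i ∈ₛ idealOf k cs → InM k (toℕ i)
  in-M i i∈ with member i i∈
  ... | σ , a , b , a+b<k , i≡ , _ = subst (InM k) (sym i≡) (cell-in-M k σ a b a+b<k)

  -- below an occupied cell in M means further from the corner of the same triangle
  down-closed : ∀ i j → i ∈ₛ idealOf k cs → InM k (toℕ j) → toℕ j ⟨ sₖ k , tₖ k ⟩⪯ toℕ i → j ∈ₛ idealOf k cs
  down-closed i j i∈ j∈M j⪯i with member i i∈ | M⇒cell k j∈M
  ... | σ , a , b , a+b<k , i≡ , occ | σ' , a' , b' , a'+b'<k , j≡
    with cell-⪯ k σ a b σ' a' b' a+b<k a'+b'<k (subst₂ (_⟨ sₖ k , tₖ k ⟩⪯_) j≡ i≡ j⪯i)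
  ...   | refl , a≤a' , b≤b' = Equivalence.from (∈-idealOf⇔ k cs j)
          (σ , a' , b' , a'+b'<k , j≡ , occupies-monotone k cs σ a b a' b' profile occ a≤a' b≤b' a'+b'<k)

  -- the two kinds of consecutive cells would need a column with both sides
  nice : ∀ i j → i ∈ₛ idealOf k cs → j ∈ₛ idealOf k cs → toℕ i ≢ toℕ j + 1
  nice i j i∈ j∈ i≡j+1 with member i i∈ | member j j∈
  ... | σ , a , b , a+b<k , i≡ , occ | σ' , a' , b' , a'+b'<k , j≡ , occ'
    with cell-consecutive k σ a b σ' a' b' a+b<k a'+b'<k (trans (sym i≡) (trans i≡j+1 (cong (_+ 1) j≡)))
  ...   | inj₁ (refl , refl , refl , refl) = A≢B (trans (sym (proj₁ occ)) (proj₁ occ'))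
  ...   | inj₂ (refl , refl , refl , refl) =
          A≢B (trans (sym (next-column-side k cs a' (suc b) profile occ' a'+b'<k (column<k a+b<k))) (proj₁ occ))

  -- 1 is a B-cell in column 0, which is an A-column; 2k is the A-cell (k − 1 , 0), in the last column, which has height 0
  avoids : ∀ i → i ∈ₛ idealOf k cs → (toℕ i ≢ 1) × (toℕ i ≢ 2 * k)
  avoids i i∈ with member i i∈
  ... | σ , a , b , a+b<k , i≡ , occ = not-one , not-2k
    where
    not-one : toℕ i ≢ 1
    not-one i≡1 with cell-injective k σ a b B 0 m a+b<k ≤-refl (trans (sym i≡) (trans i≡1 (sym (cell-one m))))
    ... | refl , refl , refl = A≢B (trans (sym first-side) (proj₁ occ))
    not-2k : toℕ i ≢ 2 * k
    not-2k i≡2k with cell-injective k σ a b A m 0 a+b<k (s≤s (≤-reflexive (+-identityʳ m)))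
                                    (trans (sym i≡) (trans i≡2k (sym (cell-2k m))))
    ... | refl , refl , refl =
          1+n≰n (subst (λ h → k ≤ h + 0 + m) (admissible-last cs m ok (sym (proj₁ profile))) (proj₂ occ))

countBelow : (ℕ → Bool) → ℕ → ℕ
countBelow Q zero    = 0
countBelow Q (suc L) = if Q L then suc (countBelow Q L) else countBelow Q L

countBelow-≤ : ∀ Q L → countBelow Q L ≤ L
countBelow-≤ Q zero = z≤n
countBelow-≤ Q (suc L) with Q L
... | true  = s≤s (countBelow-≤ Q L)
... | false = m≤n⇒m≤1+n (countBelow-≤ Q L)

countBelow-cong : ∀ Q Q' L → (∀ b → b < L → Q b ≡ Q' b) → countBelow Q L ≡ countBelow Q' L
countBelow-cong Q Q' zero same = refl
countBelow-cong Q Q' (suc L) same rewrite same L ≤-refl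
  | countBelow-cong Q Q' L (λ b b<L → same b (m≤n⇒m≤1+n b<L)) = refl

countBelow-none : ∀ Q L → (∀ b → b < L → ¬ T (Q b)) → countBelow Q L ≡ 0
countBelow-none Q zero none = refl
countBelow-none Q (suc L) none with Q L in QL
... | true  = contradiction (subst T (sym QL) _) (none L ≤-refl)
... | false = countBelow-none Q L (λ b b<L → none b (m≤n⇒m≤1+n b<L))

countBelow-threshold : ∀ d L → countBelow (d ≤ᵇ_) L ≡ L ∸ d
countBelow-threshold d zero = sym (0∸n≡0 d)
countBelow-threshold d (suc L) with d ≤ᵇ L in d≤ᵇL
... | true  = trans (cong suc (countBelow-threshold d L)) (sym (+-∸-assoc 1 (≤ᵇ⇒≤ d L (subst T (sym d≤ᵇL) _))))
... | false = trans (countBelow-threshold d L) (trans (m≤n⇒m∸n≡0 (≤-trans (n≤1+n L) L<d)) (sym (m≤n⇒m∸n≡0 L<d)))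
  where
  L<d : L < d
  L<d = ≰⇒> (λ d≤L → subst T d≤ᵇL (≤⇒≤ᵇ d≤L))

countBelow-suffix : ∀ Q L m → (∀ b → b < L → T (Q b) ⇔ L ≤ b + m) → m ≤ L → countBelow Q L ≡ m
countBelow-suffix Q L m suffix m≤L =
  trans (countBelow-cong Q ((L ∸ m) ≤ᵇ_) L same) (trans (countBelow-threshold (L ∸ m) L) (m∸[m∸n]≡n m≤L))
  where
  same : ∀ b → b < L → Q b ≡ ((L ∸ m) ≤ᵇ b)
  same b b<L = ⇔→≡ {z = true} (mk⇔
    (λ Qb → Equivalence.to T-≡ (≤⇒≤ᵇ (subst (L ∸ m ≤_) (m+n∸n≡m b m)
               (∸-monoˡ-≤ m (Equivalence.to (suffix b b<L) (Equivalence.from T-≡ Qb))))))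
    (λ thr → Equivalence.to T-≡ (Equivalence.from (suffix b b<L)
               (subst (_≤ b + m) (m∸n+n≡m m≤L) (+-monoˡ-≤ m (≤ᵇ⇒≤ (L ∸ m) b (Equivalence.from T-≡ thr)))))))

UpwardClosed : (ℕ → Bool) → ℕ → Set
UpwardClosed Q L = ∀ b → suc b < L → T (Q b) → T (Q (suc b))

upward-closed-reach : ∀ Q L → UpwardClosed Q (suc L) → ∀ b → b ≤ L → T (Q b) → T (Q L)
upward-closed-reach Q L up b b≤L Qb with m≤n⇒∃[o]m+o≡n b≤L
... | δ , b+δ≡L = step-up δ b b+δ≡L Qb
  where
  step-up : ∀ δ b → b + δ ≡ L → T (Q b) → T (Q L)
  step-up zero    b b+0≡L Qb = subst (λ x → T (Q x)) (trans (sym (+-identityʳ b)) b+0≡L) Qb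
  step-up (suc δ) b b+δ≡L Qb = step-up δ (suc b) (trans (sym (+-suc b δ)) b+δ≡L)
    (up b (s≤s (subst (suc b ≤_) (trans (sym (+-suc b δ)) b+δ≡L) (m≤m+n (suc b) δ))) Qb)

upward-closed-suffix : ∀ Q L → UpwardClosed Q L → ∀ b → b < L → T (Q b) ⇔ L ≤ b + countBelow Q L
upward-closed-suffix Q (suc L) up b b<1+L with Q L in QL
... | true with m≤n⇒m<n∨m≡n (≤-pred b<1+L)
...   | inj₂ refl = mk⇔ (λ _ → subst (suc b ≤_) (sym (+-suc b _)) (s≤s (m≤m+n b _))) (λ _ → subst T (sym QL) _)
...   | inj₁ b<L = mk⇔ (λ Qb → subst (suc L ≤_) (sym (+-suc b _)) (s≤s (Equivalence.to below Qb)))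
                       (λ L<b+c → Equivalence.from below (≤-pred (subst (suc L ≤_) (+-suc b _) L<b+c)))
  where
  below : T (Q b) ⇔ L ≤ b + countBelow Q L
  below = upward-closed-suffix Q L (λ b' b'+1<L → up b' (m≤n⇒m≤1+n b'+1<L)) b b<L
upward-closed-suffix Q (suc L) up b b<1+L | false =
  mk⇔ (λ Qb → contradiction Qb (none (≤-pred b<1+L)))
      (λ L<b+c → contradiction (≤-pred b<1+L)
                   (<⇒≱ (subst (suc L ≤_) (+-identityʳ b) (subst (λ c → suc L ≤ b + c) (countBelow-none Q L none-below) L<b+c))))
  where
  none : ∀ {b} → b ≤ L → ¬ T (Q b)
  none b≤L Qb = subst T QL (upward-closed-reach Q L up _ b≤L Qb)
  none-below : ∀ b → b < L → ¬ T (Q b)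
  none-below b b<L = none (<⇒≤ b<L)

-- Membership of natural numbers in a subset of Fin n (false beyond n).
memberℕ : ∀ {n} → Subset n → ℕ → Bool
memberℕ []       _       = false
memberℕ (x ∷ xs) zero    = x
memberℕ (x ∷ xs) (suc n) = memberℕ xs n

memberℕ-toℕ : ∀ {n} (xs : Subset n) (i : Fin n) → memberℕ xs (toℕ i) ≡ lookup xs i
memberℕ-toℕ (x ∷ xs) Fin.zero    = refl
memberℕ-toℕ (x ∷ xs) (Fin.suc i) = memberℕ-toℕ xs i

memberℕ⇔ : ∀ {n} (xs : Subset n) (i : Fin n) → T (memberℕ xs (toℕ i)) ⇔ i ∈ₛ xs
memberℕ⇔ xs i = mk⇔ (λ mem → lookup⇒[]= i xs (trans (sym (memberℕ-toℕ xs i)) (Equivalence.to T-≡ mem)))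
                    (λ i∈ → Equivalence.from T-≡ (trans (memberℕ-toℕ xs i) ([]=⇒lookup i∈)))

memberℕ-index : ∀ {n} (xs : Subset n) x → T (memberℕ xs x) → ∃ λ (i : Fin n) → toℕ i ≡ x × i ∈ₛ xs
memberℕ-index (y ∷ xs) zero    mem = Fin.zero , refl , lookup⇒[]= Fin.zero (y ∷ xs) (Equivalence.to T-≡ mem)
memberℕ-index (y ∷ xs) (suc x) mem with memberℕ-index xs x mem
... | i , refl , i∈ = Fin.suc i , refl , there i∈

zero-or-suc : ∀ n → n ≡ 0 ⊎ ∃ λ g → n ≡ suc g
zero-or-suc zero    = inj₁ refl
zero-or-suc (suc n) = inj₂ (n , refl)

cellsInColumn : ℕ → (ℕ → Bool) → Side → ℕ → ℕ
cellsInColumn k P σ a = countBelow (λ b → P (cell k σ a b)) (k ∸ a)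

columnOf : ℕ → (ℕ → Bool) → ℕ → Column
columnOf k P a = if cellsInColumn k P B a ≡ᵇ 0 then column A (cellsInColumn k P A a)
                 else column B (pred (cellsInColumn k P B a))

profileOf : ℕ → (ℕ → Bool) → List Column
profileOf k P = applyUpTo (columnOf k P) k

columnOf-A : ∀ k P a → cellsInColumn k P B a ≡ 0 → columnOf k P a ≡ column A (cellsInColumn k P A a)
columnOf-A k P a noB rewrite noB = refl

columnOf-B : ∀ k P a g → cellsInColumn k P B a ≡ suc g → columnOf k P a ≡ column B g
columnOf-B k P a g someB rewrite someB = refl

row<column-length : ∀ {k a b} → a + b < k → b < k ∸ a
row<column-length {k} {a} {b} a+b<k =
  subst (_≤ k ∸ a) (m+n∸m≡n a (suc b)) (∸-monoˡ-≤ a (subst (_≤ k) (sym (+-suc a b)) a+b<k))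

in-column⇒in-triangle : ∀ {k a b} → a ≤ k → b < k ∸ a → a + b < k
in-column⇒in-triangle {k} {a} {b} a≤k b<k∸a =
  subst (_≤ k) (+-suc a b) (subst (a + suc b ≤_) (m+[n∸m]≡n a≤k) (+-monoʳ-≤ a b<k∸a))

column-nonempty : ∀ {k a b} → b < k ∸ a → a ≤ k
column-nonempty {k} {a} {b} b<k∸a with a ≤? k
... | yes a≤k = a≤k
... | no a≰k = contradiction (subst (b <_) (m≤n⇒m∸n≡0 (<⇒≤ (≰⇒> a≰k))) b<k∸a) λ ()

∸-suc-pred : ∀ n a → suc a ≤ n → n ∸ a ≡ suc (n ∸ suc a)
∸-suc-pred (suc n) zero    _        = refl
∸-suc-pred (suc n) (suc a) (s≤s a<n) = ∸-suc-pred n a a<n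

last-cells⇔ : ∀ {k a} h b → a ≤ k → (k ∸ a ≤ b + h) ⇔ (k ≤ h + b + a)
last-cells⇔ {k} {a} h b a≤k =
  mk⇔ (λ le → subst₂ _≤_ (m∸n+n≡m a≤k) (cong (_+ a) (+-comm b h)) (+-monoˡ-≤ a le))
      (λ le → +-cancelʳ-≤ a (k ∸ a) (b + h) (subst₂ _≤_ (sym (m∸n+n≡m a≤k)) (cong (_+ a) (+-comm h b)) le))

module Extraction (m : ℕ) (I : Subset (Bound (suc m))) (counted : Counted (suc m) I) where
  k : ℕ
  k = suc m

  P : ℕ → Bool
  P = memberℕ I

  count : Side → ℕ → ℕ
  count = cellsInColumn k P

  cs : List Column
  cs = profileOf k P

  P-down-closed : ∀ x y → T (P x) → InM k y → y ⟨ sₖ k , tₖ k ⟩⪯ x → T (P y)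
  P-down-closed x y Px y∈M y⪯x with memberℕ-index I x Px
  ... | i , refl , i∈ = subst (λ z → T (P z)) j≡y
          (Equivalence.from (memberℕ⇔ I j)
            (proj₂ (proj₁ counted) i j i∈ (subst (InM k) (sym j≡y) y∈M) (subst (_⟨ sₖ k , tₖ k ⟩⪯ toℕ i) (sym j≡y) y⪯x)))
    where
    y<Bound = M<Bound k y∈M
    j = fromℕ< y<Bound
    j≡y = toℕ-fromℕ< y<Bound

  P-nice : ∀ x y → T (P x) → T (P y) → x ≢ y + 1
  P-nice x y Px Py with memberℕ-index I x Px | memberℕ-index I y Py
  ... | i , refl , i∈ | j , refl , j∈ = proj₁ (proj₂ counted) i j i∈ j∈

  P-avoids : ∀ x → T (P x) → (x ≢ 1) × (x ≢ 2 * k)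
  P-avoids x Px with memberℕ-index I x Px
  ... | i , refl , i∈ = proj₂ (proj₂ counted) i i∈

  -- The cells of a column that lie in I form a final segment of the column (covers go along the column).
  column-upward : ∀ σ a → UpwardClosed (λ b → P (cell k σ a b)) (k ∸ a)
  column-upward σ a b b+1<k∸a Pb = P-down-closed _ _ Pb (cell-in-M k σ a (suc b) a+b+1<k) (cover-row k σ a b a+b+1<k)
    where
    a+b+1<k = in-column⇒in-triangle (column-nonempty b+1<k∸a) b+1<k∸a

  in-I⇔ : ∀ σ a b → a + b < k → T (P (cell k σ a b)) ⇔ k ≤ count σ a + b + a
  in-I⇔ σ a b a+b<k = mk⇔ (λ Pcell → Equivalence.to last (Equivalence.to suffix Pcell))
                          (λ k≤ → Equivalence.from suffix (Equivalence.from last k≤))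
    where
    suffix = upward-closed-suffix (λ b → P (cell k σ a b)) (k ∸ a) (column-upward σ a) b (row<column-length a+b<k)
    last = last-cells⇔ (count σ a) b (<⇒≤ (column<k a+b<k))

  top-cell : ∀ σ a → a < k → 1 ≤ count σ a → T (P (cell k σ a (k ∸ suc a)))
  top-cell σ a a<k 1≤count = Equivalence.from (in-I⇔ σ a (k ∸ suc a) on-hypotenuse) k≤
    where
    on-hypotenuse : a + (k ∸ suc a) < k
    on-hypotenuse = ≤-reflexive (m+[n∸m]≡n a<k)
    k≤ : k ≤ count σ a + (k ∸ suc a) + a
    k≤ = subst (_≤ count σ a + (k ∸ suc a) + a) (trans (cong suc (+-comm (k ∸ suc a) a)) (m+[n∸m]≡n a<k))
               (+-monoˡ-≤ a (+-monoˡ-≤ (k ∸ suc a) 1≤count))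

  occupied⇒nonempty : ∀ σ a b → a + b < k → k ≤ count σ a + b + a → 1 ≤ count σ a
  occupied⇒nonempty σ a b a+b<k k≤ with count σ a
  ... | suc _ = s≤s z≤n
  ... | zero  = contradiction k≤ (<⇒≱ (subst (_< k) (+-comm a b) a+b<k))

  -- Niceness: the tops of the A- and B-parts of a column are consecutive numbers, and so are
  -- the top of an A-column and the top of the next B-column.
  not-both-sides : ∀ a → a < k → 1 ≤ count A a → 1 ≤ count B a → ⊥
  not-both-sides a a<k 1≤A 1≤B =
    P-nice _ _ (top-cell A a a<k 1≤A) (top-cell B a a<k 1≤B) (sym (B+1≡A k a (k ∸ suc a)))

  A-column-blocks-next-B : ∀ a → suc a < k → 1 ≤ count A a → count B (suc a) ≡ 0
  A-column-blocks-next-B a a+1<k 1≤A with zero-or-suc (count B (suc a))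
  ... | inj₁ noB = noB
  ... | inj₂ (_ , someB) = contradiction (sym (A+1≡B k a d)) (P-nice _ _ B-top A-top)
    where
    d = k ∸ suc (suc a)
    B-top : T (P (cell k B (suc a) d))
    B-top = top-cell B (suc a) a+1<k (subst (1 ≤_) (sym someB) (s≤s z≤n))
    A-top : T (P (cell k A a (suc d)))
    A-top = subst (λ b → T (P (cell k A a b))) (∸-suc-pred k (suc a) a+1<k) (top-cell A a (<⇒≤ a+1<k) 1≤A)

  count≤ : ∀ σ a → count σ a ≤ k ∸ a
  count≤ σ a = countBelow-≤ _ (k ∸ a)

  -- Heights drop by at most one from a column to the next: if column a holds h ≥ 2 cells, its
  -- lowest one (a , b) covers (a + 1 , b), which therefore lies in I as well.
  count-step : ∀ σ a → suc a < k → count σ a ≤ suc (count σ (suc a))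
  count-step σ a a+1<k = by-value (count σ a) refl
    where
    by-value : ∀ h → count σ a ≡ h → h ≤ suc (count σ (suc a))
    by-value zero          _    = z≤n
    by-value (suc zero)    _    = s≤s z≤n
    by-value (suc (suc x)) h≡ with m≤n⇒∃[o]m+o≡n (subst (_≤ k) (cong (_+ a) h≡)
                                   (subst (count σ a + a ≤_) (m∸n+n≡m (<⇒≤ (<-trans (n<1+n a) a+1<k))) (+-monoˡ-≤ a (count≤ σ a))))
    ... | b , h+a+b≡k = +-cancelʳ-≤ b _ _ (+-cancelʳ-≤ a _ _ (begin
          suc (suc x) + b + a           ≡⟨ regroup (suc (suc x)) a b ⟩
          suc (suc x) + a + b           ≡⟨ h+a+b≡k ⟩
          k                             ≤⟨ Equivalence.to (in-I⇔ σ (suc a) b a+1+b<k) next-in-I ⟩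
          count σ (suc a) + b + suc a   ≡⟨ +-suc (count σ (suc a) + b) a ⟩
          suc (count σ (suc a)) + b + a ∎))
      where
      open ≤-Reasoning
      regroup : ∀ h a b → h + b + a ≡ h + a + b
      regroup = solve-∀
      split₁ : ∀ x a b → suc (a + b) + suc x ≡ suc (suc x) + a + b
      split₁ = solve-∀
      split₂ : ∀ x a b → suc (suc a + b) + x ≡ suc (suc x) + a + b
      split₂ = solve-∀
      a+b<k : a + b < k
      a+b<k = m+n≤o⇒m≤o _ (≤-reflexive (trans (split₁ x a b) h+a+b≡k))
      a+1+b<k : suc a + b < k
      a+1+b<k = m+n≤o⇒m≤o _ (≤-reflexive (trans (split₂ x a b) h+a+b≡k))
      lowest-in-I : T (P (cell k σ a b))
      lowest-in-I = Equivalence.from (in-I⇔ σ a b a+b<k)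
                      (≤-reflexive (sym (trans (cong (λ h → h + b + a) h≡) (trans (regroup (suc (suc x)) a b) h+a+b≡k))))
      next-in-I : T (P (cell k σ (suc a) b))
      next-in-I = P-down-closed _ _ lowest-in-I (cell-in-M k σ (suc a) b a+1+b<k) (cover-column k σ a b a+1+b<k)

  -- Column 0 has no B-cell (that would put 1 = B (0 , k − 1) into I), the last column no A-cell
  -- (2k = A (k − 1 , 0)), and the last column has a single cell.
  first-column-no-B : count B 0 ≡ 0
  first-column-no-B with zero-or-suc (count B 0)
  ... | inj₁ noB = noB
  ... | inj₂ (_ , someB) =
        contradiction (cell-one m) (proj₁ (P-avoids _ (top-cell B 0 (s≤s z≤n) (subst (1 ≤_) (sym someB) (s≤s z≤n)))))

  last-column-no-A : count A m ≡ 0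
  last-column-no-A with zero-or-suc (count A m)
  ... | inj₁ noA = noA
  ... | inj₂ (_ , someA) = contradiction (trans (cong (cell k A m) (n∸n≡0 m)) (cell-2k m))
                             (proj₂ (P-avoids _ (top-cell A m ≤-refl (subst (1 ≤_) (sym someA) (s≤s z≤n)))))

  last-column-small : count B m ≤ 1
  last-column-small = subst (count B m ≤_) (trans (∸-suc-pred k m ≤-refl) (cong suc (n∸n≡0 m))) (count≤ B m)

  column-follows : ∀ a → suc a < k → Follows (columnOf k P a) (columnOf k P (suc a))
  column-follows a a+1<k with zero-or-suc (count B a)
  ... | inj₁ noB with zero-or-suc (count A a)
  ...   | inj₁ noA = subst (λ c → Follows c (columnOf k P (suc a))) (sym (columnOf-A k P a noB)) (inj₁ noA)
  ...   | inj₂ (g , someA) = subst₂ Follows (sym (columnOf-A k P a noB)) (sym (columnOf-A k P (suc a) next-no-B))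
                               (inj₂ (refl , count-step A a a+1<k))
    where
    next-no-B = A-column-blocks-next-B a a+1<k (subst (1 ≤_) (sym someA) (s≤s z≤n))
  column-follows a a+1<k | inj₂ (zero , oneB) = subst (λ c → Follows c (columnOf k P (suc a))) (sym (columnOf-B k P a 0 oneB)) (inj₁ refl)
  column-follows a a+1<k | inj₂ (suc g , someB) with zero-or-suc (count B (suc a))
  ... | inj₁ noB' = contradiction (subst₂ _≤_ someB (cong suc noB') (count-step B a a+1<k)) λ { (s≤s ()) }
  ... | inj₂ (g' , someB') = subst₂ Follows (sym (columnOf-B k P a (suc g) someB)) (sym (columnOf-B k P (suc a) g' someB'))
                               (inj₂ (refl , ≤-pred (subst₂ _≤_ someB (cong suc someB') (count-step B a a+1<k))))

  column-cases : ∀ a → a < k → (count B a ≡ 0 × columnAt cs a ≡ column A (count A a))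
                             ⊎ (∃ λ g → count B a ≡ suc g × columnAt cs a ≡ column B g)
  column-cases a a<k with zero-or-suc (count B a)
  ... | inj₁ noB = inj₁ (noB , trans (columnAt-applyUpTo (columnOf k P) k a a<k) (columnOf-A k P a noB))
  ... | inj₂ (g , someB) = inj₂ (g , someB , trans (columnAt-applyUpTo (columnOf k P) k a a<k) (columnOf-B k P a g someB))

  profile : Profile k cs
  profile = length≡k , admissible-from cs (subst (1 ≤_) (sym length≡k) (s≤s z≤n)) follows last , first-side
    where
    length≡k : length cs ≡ k
    length≡k = length-applyUpTo (columnOf k P) k
    follows : ∀ a → suc a < length cs → Follows (columnAt cs a) (columnAt cs (suc a))
    follows a a+1<len = subst₂ Follows (sym (columnAt-applyUpTo (columnOf k P) k a (<-trans (n<1+n a) a+1<k)))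
                                       (sym (columnAt-applyUpTo (columnOf k P) k (suc a) a+1<k)) (column-follows a a+1<k)
      where
      a+1<k = subst (suc a <_) length≡k a+1<len
    last : ∀ a → suc a ≡ length cs → height (columnAt cs a) ≡ 0
    last a a+1≡len with suc-injective (trans a+1≡len length≡k)
    ... | refl with column-cases m ≤-refl
    ...   | inj₁ (_ , A-column) = trans (cong height A-column) last-column-no-A
    ...   | inj₂ (g , someB , B-column) = trans (cong height B-column) (≤-antisym (≤-pred (subst (_≤ 1) someB last-column-small)) z≤n)
    first-side : side (columnAt cs 0) ≡ A
    first-side with column-cases 0 (s≤s z≤n)
    ... | inj₁ (_ , A-column) = cong side A-column
    ... | inj₂ (g , someB , _) = contradiction (trans (sym someB) first-column-no-B) λ ()

  in-I⇔occupies : ∀ σ a b → a + b < k → T (P (cell k σ a b)) ⇔ Occupies k cs σ a b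
  in-I⇔occupies σ a b a+b<k with column-cases a (column<k a+b<k)
  in-I⇔occupies A a b a+b<k | inj₁ (_ , A-column) =
    mk⇔ (λ Pcell → cong side A-column , subst (λ c → k ≤ height c + b + a) (sym A-column) (Equivalence.to (in-I⇔ A a b a+b<k) Pcell))
        (λ (_ , k≤) → Equivalence.from (in-I⇔ A a b a+b<k) (subst (λ c → k ≤ height c + b + a) A-column k≤))
  in-I⇔occupies A a b a+b<k | inj₂ (g , someB , B-column) =
    mk⇔ (λ Pcell → contradiction (subst (1 ≤_) (sym someB) (s≤s z≤n))
                     (not-both-sides a (column<k a+b<k) (occupied⇒nonempty A a b a+b<k (Equivalence.to (in-I⇔ A a b a+b<k) Pcell))))
        (λ (A-side , _) → contradiction (trans (sym (cong side B-column)) A-side) λ ())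
  in-I⇔occupies B a b a+b<k | inj₁ (noB , A-column) =
    mk⇔ (λ Pcell → contradiction (occupied⇒nonempty B a b a+b<k (Equivalence.to (in-I⇔ B a b a+b<k) Pcell))
                     (subst (λ c → ¬ 1 ≤ c) (sym noB) λ ()))
        (λ (B-side , _) → contradiction (trans (sym (cong side A-column)) B-side) λ ())
  in-I⇔occupies B a b a+b<k | inj₂ (g , someB , B-column) =
    mk⇔ (λ Pcell → cong side B-column ,
                   subst (λ c → k ≤ 1 + height c + b + a) (sym B-column)
                     (subst (λ h → k ≤ h + b + a) someB (Equivalence.to (in-I⇔ B a b a+b<k) Pcell)))
        (λ (_ , k≤) → Equivalence.from (in-I⇔ B a b a+b<k)
                        (subst (λ h → k ≤ h + b + a) (sym someB) (subst (λ c → k ≤ 1 + height c + b + a) B-column k≤)))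

  I≡idealOf : I ≡ idealOf k cs
  I≡idealOf = ⊆-antisym (λ {i} i∈I → Equivalence.from (∈-idealOf⇔ k cs i) (in-ideal i i∈I))
                        (λ {i} i∈ideal → in-I i (Equivalence.to (∈-idealOf⇔ k cs i) i∈ideal))
    where
    in-ideal : ∀ i → i ∈ₛ I → InIdealOf k cs (toℕ i)
    in-ideal i i∈I with M⇒cell k (proj₁ (proj₁ counted) i i∈I)
    ... | σ , a , b , a+b<k , i≡ = σ , a , b , a+b<k , i≡ ,
          Equivalence.to (in-I⇔occupies σ a b a+b<k) (subst (λ x → T (P x)) i≡ (Equivalence.from (memberℕ⇔ I i) i∈I))
    in-I : ∀ i → InIdealOf k cs (toℕ i) → i ∈ₛ I
    in-I i (σ , a , b , a+b<k , i≡ , occ) =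
      Equivalence.to (memberℕ⇔ I i) (subst (λ x → T (P x)) (sym i≡) (Equivalence.from (in-I⇔occupies σ a b a+b<k) occ))

-- A profile can be read back from its ideal, so distinct profiles give distinct ideals.
module Readback (m : ℕ) (cs : List Column) (profile : Profile (suc m) cs) where
  k : ℕ
  k = suc m

  P : ℕ → Bool
  P = memberℕ (idealOf k cs)

  P⇔occupies : ∀ σ a b → a + b < k → T (P (cell k σ a b)) ⇔ Occupies k cs σ a b
  P⇔occupies σ a b a+b<k = mk⇔
    (λ Pcell → from-ideal (Equivalence.to (∈-idealOf⇔ k cs j)
                 (Equivalence.to (memberℕ⇔ (idealOf k cs) j) (subst (λ x → T (P x)) (sym j≡) Pcell))))
    (λ occ → subst (λ x → T (P x)) j≡ (Equivalence.from (memberℕ⇔ (idealOf k cs) j)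
               (Equivalence.from (∈-idealOf⇔ k cs j) (σ , a , b , a+b<k , j≡ , occ))))
    where
    j = fromℕ< (cell<Bound k σ a b a+b<k)
    j≡ = toℕ-fromℕ< (cell<Bound k σ a b a+b<k)
    from-ideal : InIdealOf k cs (toℕ j) → Occupies k cs σ a b
    from-ideal (σ' , a' , b' , a'+b'<k , j≡' , occ) with cell-injective k σ a b σ' a' b' a+b<k a'+b'<k (trans (sym j≡) j≡')
    ... | refl , refl , refl = occ

  count-own-side : ∀ σ a → a < k → side (columnAt cs a) ≡ σ → cellsInColumn k P σ a ≡ offset σ + height (columnAt cs a)
  count-own-side σ a a<k σ-side = countBelow-suffix (λ b → P (cell k σ a b)) (k ∸ a) (offset σ + height (columnAt cs a)) last-cells fits
    where
    last-cells : ∀ b → b < k ∸ a → T (P (cell k σ a b)) ⇔ (k ∸ a ≤ b + (offset σ + height (columnAt cs a)))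
    last-cells b b<k∸a = mk⇔ (λ Pcell → Equivalence.from shift (proj₂ (Equivalence.to (P⇔occupies σ a b a+b<k) Pcell)))
                             (λ le → Equivalence.from (P⇔occupies σ a b a+b<k) (σ-side , Equivalence.to shift le))
      where
      a+b<k = in-column⇒in-triangle (<⇒≤ a<k) b<k∸a
      shift = last-cells⇔ (offset σ + height (columnAt cs a)) b (<⇒≤ a<k)
    height+a<k : height (columnAt cs a) + a < k
    height+a<k = subst (height (columnAt cs a) + a <_) (proj₁ profile)
                   (admissible-height-at cs a (proj₁ (proj₂ profile)) (subst (a <_) (sym (proj₁ profile)) a<k))
    fits : offset σ + height (columnAt cs a) ≤ k ∸ a
    fits = subst (_≤ k ∸ a) (m+n∸n≡m _ a) (∸-monoˡ-≤ a (≤-trans (+-monoˡ-≤ a (+-monoˡ-≤ _ (offset≤1 σ))) height+a<k))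
      where
      offset≤1 : ∀ σ → offset σ ≤ 1
      offset≤1 A = z≤n
      offset≤1 B = ≤-refl

  count-other-side : ∀ σ a → a < k → side (columnAt cs a) ≢ σ → cellsInColumn k P σ a ≡ 0
  count-other-side σ a a<k other = countBelow-none _ (k ∸ a)
    (λ b b<k∸a Pcell → other (proj₁ (Equivalence.to (P⇔occupies σ a b (in-column⇒in-triangle (<⇒≤ a<k) b<k∸a)) Pcell)))

  columnOf-readback : ∀ a → a < k → columnOf k P a ≡ columnAt cs a
  columnOf-readback a a<k with columnAt cs a in column-a
  ... | column A h = trans (columnOf-A k P a (count-other-side B a a<k (λ A≡B → A≢B (trans (sym (cong side column-a)) A≡B))))
                           (cong (column A) (trans (count-own-side A a a<k (cong side column-a)) (cong height column-a)))
  ... | column B h = columnOf-B k P a h (trans (count-own-side B a a<k (cong side column-a)) (cong (λ c → suc (height c)) column-a))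

  profileOf-idealOf : profileOf k P ≡ cs
  profileOf-idealOf = applyUpTo-columnAt (columnOf k P) cs k (proj₁ profile) columnOf-readback

profiles : ℕ → List (List Column)
profiles m = startingAtLeast m A 0

∈profiles⇒profile : ∀ m {cs} → cs ∈ profiles m → Profile (suc m) cs
∈profiles⇒profile m {cs} cs∈ with startingAtLeast-sound m A 0 cs cs∈
... | w , _ , cs∈' with startingWith-sound m A w cs cs∈'
...   | r , refl , len , admissible = cong suc len , admissible , refl

profile⇒∈profiles : ∀ m {cs} → Profile (suc m) cs → cs ∈ profiles m
profile⇒∈profiles m {column .A w ∷ r} (len , admissible , refl) =
  startingAtLeast-complete m A 0 w r admissible (suc-injective len) z≤n

counted⇔ideal-of-profile : ∀ m I → Counted (suc m) I ⇔ I ∈ map (idealOf (suc m)) (profiles m)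
counted⇔ideal-of-profile m I = mk⇔ counted⇒listed listed⇒counted
  where
  counted⇒listed : Counted (suc m) I → I ∈ map (idealOf (suc m)) (profiles m)
  counted⇒listed counted = subst (_∈ map (idealOf (suc m)) (profiles m)) (sym (Extraction.I≡idealOf m I counted))
    (∈-map⁺ (idealOf (suc m)) (profile⇒∈profiles m (Extraction.profile m I counted)))
  listed⇒counted : I ∈ map (idealOf (suc m)) (profiles m) → Counted (suc m) I
  listed⇒counted I∈ with ∈-map⁻ (idealOf (suc m)) I∈
  ... | cs , cs∈ , refl = idealOf-counted m cs (∈profiles⇒profile m cs∈)

idealOf-injective : ∀ m {cs cs'} → Profile (suc m) cs → Profile (suc m) cs' → idealOf (suc m) cs ≡ idealOf (suc m) cs' → cs ≡ cs'
idealOf-injective m {cs} {cs'} profile profile' same = begin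
  cs                                                ≡⟨ sym (Readback.profileOf-idealOf m cs profile) ⟩
  profileOf (suc m) (memberℕ (idealOf (suc m) cs))  ≡⟨ cong (λ I → profileOf (suc m) (memberℕ I)) same ⟩
  profileOf (suc m) (memberℕ (idealOf (suc m) cs')) ≡⟨ Readback.profileOf-idealOf m cs' profile' ⟩
  cs'                                               ∎
  where open ≡-Reasoning

profiles-count : ∀ m → length (profiles m) ≡ (2 * suc m ∸ 1) C suc m
profiles-count m = begin
  length (profiles m)             ≡⟨ startingAtLeast-length m A 0 m refl ⟩
  (suc m + m) C m                 ≡⟨ nCk≡nC[n∸k] (m≤n+m m (suc m)) ⟩
  (suc m + m) C (suc m + m ∸ m)   ≡⟨ cong ((suc m + m) C_) (m+n∸n≡m (suc m) m) ⟩
  (suc m + m) C suc m             ≡⟨ cong (λ n → (n ∸ 1) C suc m) (sym (two-k m)) ⟩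
  (2 * suc m ∸ 1) C suc m         ∎
  where
  open ≡-Reasoning
  two-k : ∀ m → 2 * suc m ≡ suc (suc m + m)
  two-k = solve-∀

lemma5 : (k : ℕ) → 1 ≤ k →
    Σ (List (Subset (Bound k))) λ L →
      Unique L × (∀ I → Counted k I ⇔ I ∈ L) × (length L ≡ (2 * k ∸ 1) C k)
lemma5 (suc m) _ =
  map (idealOf (suc m)) (profiles m) ,
  map-unique (idealOf (suc m)) (idealOf-injective m) (All.tabulate (∈profiles⇒profile m)) (startingAtLeast-unique m A 0) ,
  counted⇔ideal-of-profile m ,
  trans (length-map (idealOf (suc m)) (profiles m)) (profiles-count m)
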